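{- Let $G$ be a connected graph with at least one edge. Then $$\inf_{\omega\in W} t_\omega(G)=\min_{S\in Co(G)}\frac{|S|-1}{e(G[S])},$$ where $Co(G)=\{S\subseteq V(G)\,:\, G[S]\text{ is connected}\}$.
   Context: Graphs are finite, simple and undirected. $G[S]$ is the subgraph induced by $S$ and $e(H)$ is the number of edges of $H$. Let $W$ be the set of functions $\omega:E(G)\to\mathbb{R}_{\ge 0}$ that are not identically zero. Write $\omega(H)=\sum_{e\in E(H)}\omega(e)$ and $\omega(G)=\sum_{e\in E(G)}\omega(e)$. Let $T_\omega$ be a maximum spanning tree of $G$ with respect to $\omega$, i.e. a spanning tree maximizing $\omega(T)$. The weighting ratio is $t_\omega(G)=\omega(T_\omega)/\omega(G)$. In the minimum over $Co(G)$ only sets $S$ with $|S|\ge 2$ are considered, since otherwise the quotient is $0/0$.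
   Formalization: The weightings ω in W take values in the nonnegative rationals rather than in $\mathbb{R}_{\ge 0}$. -}

module Defs where

open import Data.Nat as ℕ using (ℕ; _∸_)
open import Data.Bool using (Bool; true; false; T)
open import Data.Fin using (Fin; _<_)
open import Data.Fin.Properties using (_<?_)
open import Data.Fin.Subset using (Subset; _∈_; ∣_∣)
open import Data.Fin.Subset.Properties using (_∈?_)
open import Data.List using (List; []; _∷_; _++_; [_]; length; filter; cartesianProduct; allFin; foldr; map)
open import Data.List.Relation.Unary.Linked using (Linked)
open import Data.List.Relation.Unary.Unique.Propositional using (Unique)
open import Data.Product using (_×_; _,_; proj₁; proj₂; Σ; ∃; ∃₂)
open import Data.Sum using (_⊎_)
open import Data.Integer using (+_)
open import Data.Rational as ℚ using (ℚ; 0ℚ; _÷_; ≢-nonZero)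
open import Relation.Nullary using (¬_; yes; no)
open import Relation.Nullary.Decidable using (T?; _×-dec_)
open import Relation.Binary.PropositionalEquality using (_≡_)

record Graph : Set where
  field
    n      : ℕ
    adj    : Fin n → Fin n → Bool
    sym    : ∀ i j → adj i j ≡ adj j i
    irrefl : ∀ i → adj i i ≡ false
open Graph public

data Reach {A : Set} (R : A → A → Set) : A → A → Set where
  here : ∀ {a} → Reach R a a
  step : ∀ {a b c} → R a b → Reach R b c → Reach R a c

-- unordered pairs {i,j} represented as (i , j) with i < j
pairs : (n : ℕ) → List (Fin n × Fin n)
pairs n = filter (λ p → proj₁ p <? proj₂ p) (cartesianProduct (allFin n) (allFin n))

edges : (G : Graph) → List (Fin (n G) × Fin (n G))
edges G = filter (λ p → T? (adj G (proj₁ p) (proj₂ p))) (pairs (n G))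

Adj : (G : Graph) → Fin (n G) → Fin (n G) → Set
Adj G u v = T (adj G u v)

Connected : Graph → Set
Connected G = ∀ u v → Reach (Adj G) u v

HasEdge : Graph → Set
HasEdge G = ∃₂ λ u v → Adj G u v

InducedConnected : (G : Graph) → Subset (n G) → Set
InducedConnected G S =
  ∀ u v → u ∈ S → v ∈ S → Reach (λ a b → a ∈ S × b ∈ S × Adj G a b) u v

eInduced : (G : Graph) → Subset (n G) → ℕ
eInduced G S =
  length (filter (λ p → (proj₁ p ∈? S) ×-dec (proj₂ p ∈? S)) (edges G))

-- Edge subsets of G: a Boolean on pairs, read only at pairs (i , j) with i < j.
EdgeSet : Graph → Set
EdgeSet G = Fin (n G) → Fin (n G) → Bool

edgeList : (G : Graph) → EdgeSet G → List (Fin (n G) × Fin (n G))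
edgeList G F = filter (λ p → T? (F (proj₁ p) (proj₂ p))) (edges G)

AdjF : (G : Graph) → EdgeSet G → Fin (n G) → Fin (n G) → Set
AdjF G F u v = (u < v × Adj G u v × T (F u v)) ⊎ (v < u × Adj G v u × T (F v u))

HasCycle : (G : Graph) → EdgeSet G → Set
HasCycle G F = Σ (Fin (n G)) λ v0 → Σ (List (Fin (n G))) λ vs →
  Unique (v0 ∷ vs) × 2 ℕ.≤ length vs × Linked (AdjF G F) (v0 ∷ vs ++ [ v0 ])

SpanningTree : (G : Graph) → EdgeSet G → Set
SpanningTree G F = (∀ u v → Reach (AdjF G F) u v) × ¬ HasCycle G F

Weight : Graph → Set
Weight G = Fin (n G) → Fin (n G) → ℚ

sumQ : List ℚ → ℚ
sumQ = foldr ℚ._+_ 0ℚ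

ωsum : (G : Graph) → Weight G → List (Fin (n G) × Fin (n G)) → ℚ
ωsum G ω es = sumQ (map (λ p → ω (proj₁ p) (proj₂ p)) es)

ωG : (G : Graph) → Weight G → ℚ
ωG G ω = ωsum G ω (edges G)

ωT : (G : Graph) → Weight G → EdgeSet G → ℚ
ωT G ω F = ωsum G ω (edgeList G F)

InW : (G : Graph) → Weight G → Set
InW G ω = (∀ u v → u < v → Adj G u v → 0ℚ ℚ.≤ ω u v)
        × (∃₂ λ u v → u < v × Adj G u v × ¬ (ω u v ≡ 0ℚ))

IsMaxST : (G : Graph) → Weight G → EdgeSet G → Set
IsMaxST G ω F = SpanningTree G F × (∀ F' → SpanningTree G F' → ωT G ω F' ℚ.≤ ωT G ω F)

-- division, total (value 0 when dividing by 0; never used in that case)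
divQ : ℚ → ℚ → ℚ
divQ p q with q ℚ.≟ 0ℚ
... | yes _  = 0ℚ
... | no q≢0 = _÷_ p q {{≢-nonZero q≢0}}

ℕtoℚ : ℕ → ℚ
ℕtoℚ k = (+ k) ℚ./ 1

-- t_ω(G) computed from a maximum spanning tree T
tω : (G : Graph) → Weight G → EdgeSet G → ℚ
tω G ω F = divQ (ωT G ω F) (ωG G ω)

ratio : (G : Graph) → Subset (n G) → ℚ
ratio G S = divQ (ℕtoℚ (∣ S ∣ ∸ 1)) (ℕtoℚ (eInduced G S))

InCo₂ : (G : Graph) → Subset (n G) → Set
InCo₂ G S = InducedConnected G S × 2 ℕ.≤ ∣ S ∣

IsMinCo : (G : Graph) → ℚ → Set
IsMinCo G m = (Σ (Subset (n G)) λ S → InCo₂ G S × ratio G S ≡ m)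
            × (∀ S → InCo₂ G S → m ℚ.≤ ratio G S)

IsInfT : (G : Graph) → ℚ → Set
IsInfT G m = (∀ ω F → InW G ω → IsMaxST G ω F → m ℚ.≤ tω G ω F)
           × (∀ ε → 0ℚ ℚ.< ε → Σ (Weight G) λ ω → Σ (EdgeSet G) λ F →
                InW G ω × IsMaxST G ω F × tω G ω F ℚ.< m ℚ.+ ε)

{-# OPTIONS --safe #-}
module Submission where

open import Defs hiding (sym)
open import Data.Rational using (ℚ)
open import Data.Product using (Σ; _×_)

open import Algebra.Bundles using (Semiring; Ring)
open import Data.Bool using (Bool; true; false; T; _∧_; _∨_; not; if_then_else_; _xor_)
import Data.Bool.Properties as BoolP
open import Data.Empty using (⊥-elim)
open import Data.Fin as Fin using (Fin; zero; suc)
import Data.Fin.Properties as FinP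
open import Data.Fin.Subset using (Subset; _∈_; _∉_; _⊆_; ∣_∣; ⁅_⁆; _-_; _∪_)
open import Data.Fin.Subset.Properties using (_∈?_)
import Data.Fin.Subset.Properties as SubsetP
import Data.Integer as ℤ
import Data.Integer.Properties as ℤP
open import Data.List using (List; []; _∷_; _++_; map; filter; foldr; cartesianProduct; allFin; tabulate; length)
import Data.List.Properties as ListP
open import Data.List.Membership.Propositional using () renaming (_∈_ to _∈ₗ_)
open import Data.List.Membership.Propositional.Properties
  using (∈-∃++; ∈-filter⁺; ∈-filter⁻; ∈-cartesianProduct⁺; ∈-allFin; ∈-++⁺ˡ; ∈-++⁺ʳ; ∈-map⁺)
open import Data.List.Relation.Binary.Permutation.Propositional using (↭-sym)
open import Data.List.Relation.Binary.Permutation.Propositional.Properties using (∈-resp-↭)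
open import Data.List.Relation.Unary.All as All using (All; []; _∷_)
open import Data.List.Relation.Unary.All.Properties using (¬Any⇒All¬; all-filter)
open import Data.List.Relation.Unary.AllPairs using ([]; _∷_)
open import Data.List.Relation.Unary.Any using (here; there)
import Data.List.Relation.Unary.Any as Any
open import Data.List.Relation.Unary.Linked as Linked using (Linked; []; [-]; _∷_)
import Data.List.Relation.Unary.Linked.Properties as LinkedP
open import Data.List.Relation.Unary.Unique.Propositional using (Unique)
import Data.List.Sort as Sort
open import Data.Nat as ℕ using (ℕ; zero; suc; _+_; _∸_; z≤n; s≤s)
import Data.Nat.Coprimality as Coprime
import Data.Nat.Properties as ℕP
open import Data.Nat.Tactic.RingSolver using (solve-∀)
open import Data.Product using (∃; ∃₂; _,_; proj₁; proj₂)
import Data.Rational as ℚ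
import Data.Rational.Properties as ℚP
import Data.Rational.Solver as ℚSolver
open ℚSolver.+-*-Solver using (_:+_; _:*_; _:-_; _:=_; con)
open import Data.Sum using (_⊎_; inj₁; inj₂)
open import Data.Vec using ([]; _∷_)
import Data.Vec as Vec
open import Function using (_∘_; id; Equivalence; _⇔_; mk⇔)
import Function.Properties.Equivalence as ⇔
open import Level using (0ℓ)
open import Relation.Binary.Bundles using (DecTotalOrder)
import Relation.Binary.Construct.Flip.EqAndOrd as Flip
import Relation.Binary.Construct.On as On
open import Relation.Binary.Definitions using (DecidableEquality; tri<; tri≈; tri>)
open import Relation.Binary.PropositionalEquality
  using (_≡_; _≢_; refl; sym; trans; cong; cong₂; subst; subst₂; ≢-sym; module ≡-Reasoning)
open import Relation.Nullary using (Dec; yes; no; does; ¬_)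
open import Relation.Nullary.Decidable using (dec-true; dec-false; T?; _×-dec_; _→-dec_)
import Relation.Nullary.Decidable as Dec

-- Let m be the minimum of (|S| - 1)/e(G[S]) over S ∈ Co(G).
--
-- Run Kruskal's algorithm on ω, processing the edges by non-increasing weight.
-- At every stage the components of the accepted forest induce connected subgraphs, and every
-- processed edge lies inside one of them; so minimality of m gives
-- m · #processed ≤ Σ (|component| - 1) = #accepted.  Writing ω(G) and ω(T) as sums over the
-- weight thresholds (Abel summation) turns these counting inequalities into m · ω(G) ≤ ω(T) for
-- the Kruskal tree T, and hence for every maximum spanning tree.
--
-- For a minimising S, weight the edges of G[S] by 1 and all others by 0.  A
-- spanning tree has at most |S| - 1 edges inside S, and by the lower bound the Kruskal tree has
-- at least m · e(G[S]) = |S| - 1 of them; so it is a maximum spanning tree with ratio exactly m.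

_≟_ : ∀ {m} → Fin m → Fin m → Bool
x ≟ y = does (x FinP.≟ y)

𝟙 : Bool → ℕ
𝟙 b = if b then 1 else 0

does-sound : ∀ {P : Set} (P? : Dec P) → T (does P?) → P
does-sound (yes p) _ = p

does-complete : ∀ {P : Set} (P? : Dec P) → P → T (does P?)
does-complete P? p = subst T (sym (dec-true P? p)) _

does-T? : ∀ b → does (T? b) ≡ b
does-T? true  = refl
does-T? false = refl

T-∧⁻ : ∀ a {b} → T (a ∧ b) → T a × T b
T-∧⁻ a = Equivalence.to (BoolP.T-∧ {a})

T-∧⁺ : ∀ {a b} → T a → T b → T (a ∧ b)
T-∧⁺ ta tb = Equivalence.from BoolP.T-∧ (ta , tb)

≟-refl : ∀ {m} (x : Fin m) → x ≟ x ≡ true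
≟-refl x = dec-true (x FinP.≟ x) refl

≟-≢ : ∀ {m} {x y : Fin m} → x ≢ y → x ≟ y ≡ false
≟-≢ {x = x} {y} = dec-false (x FinP.≟ y)

≟-sym : ∀ {m} (x y : Fin m) → x ≟ y ≡ y ≟ x
≟-sym x y with x FinP.≟ y | y FinP.≟ x
... | yes _   | yes _   = refl
... | no  _   | no  _   = refl
... | yes x≡y | no  y≢x = ⊥-elim (y≢x (sym x≡y))
... | no  x≢y | yes y≡x = ⊥-elim (x≢y (sym y≡x))

≟-pair-≢ : ∀ {m} {u v p q : Fin m} → ¬ (u ≡ p × v ≡ q) → (u ≟ p ∧ v ≟ q) ≡ false
≟-pair-≢ {u = u} {v} {p} {q} uv≢pq with u FinP.≟ p | v FinP.≟ q
... | yes u≡p | yes v≡q = ⊥-elim (uv≢pq (u≡p , v≡q))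
... | yes _   | no _    = refl
... | no _    | _       = refl

≡⇒T≟ : ∀ {m} {x y : Fin m} → x ≡ y → T (x ≟ y)
≡⇒T≟ {x = x} {y} = does-complete (x FinP.≟ y)

T≟⇒≡ : ∀ {m} {x y : Fin m} → T (x ≟ y) → x ≡ y
T≟⇒≡ {x = x} {y} = does-sound (x FinP.≟ y)

𝟙≟-yes : ∀ {m} {x y : Fin m} → x ≡ y → 𝟙 (x ≟ y) ≡ 1
𝟙≟-yes {x = x} refl = cong 𝟙 (≟-refl x)

𝟙≟-no : ∀ {m} {x y : Fin m} → x ≢ y → 𝟙 (x ≟ y) ≡ 0
𝟙≟-no x≢y = cong 𝟙 (≟-≢ x≢y)

𝟙-mono : ∀ {a b} → (T a → T b) → 𝟙 a ℕ.≤ 𝟙 b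
𝟙-mono {false}          _   = z≤n
𝟙-mono {true}  {true}   _   = ℕP.≤-refl
𝟙-mono {true}  {false} a⇒b = ⊥-elim (a⇒b _)

xor-cancelʳ : ∀ a b c → a xor c ≡ b xor c → a ≡ b
xor-cancelʳ false false _     _  = refl
xor-cancelʳ true  true  _     _  = refl
xor-cancelʳ false true  false ()
xor-cancelʳ false true  true  ()
xor-cancelʳ true  false false ()
xor-cancelʳ true  false true  ()

xor-swap : ∀ a b → b xor (a xor b) ≡ a
xor-swap false false = refl
xor-swap false true  = refl
xor-swap true  false = refl
xor-swap true  true  = refl

PairSet : ℕ → Set
PairSet m = Fin m → Fin m → Bool

_∧₂_ : ∀ {m} → PairSet m → PairSet m → PairSet m
(X ∧₂ Y) u v = X u v ∧ Y u v

_⊆₂_ : ∀ {m} → PairSet m → PairSet m → Set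
X ⊆₂ Y = ∀ {u v} → T (X u v) → T (Y u v)

⊆₂-antisym : ∀ {m} {X Y : PairSet m} → X ⊆₂ Y → Y ⊆₂ X → ∀ u v → X u v ≡ Y u v
⊆₂-antisym {X = X} {Y} X⊆Y Y⊆X u v with X u v in x | Y u v in y
... | true  | true  = refl
... | false | false = refl
... | true  | false = ⊥-elim (subst T y (X⊆Y (subst T (sym x) _)))
... | false | true  = ⊥-elim (subst T x (Y⊆X (subst T (sym y) _)))

insert : ∀ {m} → PairSet m → Fin m → Fin m → PairSet m
insert X p q u v = X u v ∨ (u ≟ p ∧ v ≟ q)

insert-⊇ : ∀ {m} (X : PairSet m) {p q} → X ⊆₂ insert X p q
insert-⊇ X uv∈X = Equivalence.from BoolP.T-∨ (inj₁ uv∈X)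

insert-new : ∀ {m} (X : PairSet m) p q → T (insert X p q p q)
insert-new X p q = Equivalence.from BoolP.T-∨ (inj₂ (T-∧⁺ (≡⇒T≟ {x = p} refl) (≡⇒T≟ {x = q} refl)))

insert-cases : ∀ {m} {X : PairSet m} {p q u v} → T (insert X p q u v) → T (X u v) ⊎ (u ≡ p × v ≡ q)
insert-cases {X = X} {p} {q} {u} {v} uv∈ with Equivalence.to (BoolP.T-∨ {X u v}) uv∈
... | inj₁ old = inj₁ old
... | inj₂ new = let u≟p , v≟q = T-∧⁻ (u ≟ p) new in inj₂ (T≟⇒≡ u≟p , T≟⇒≡ v≟q)

insert-elim : ∀ {m} (X : PairSet m) {p q} (P : Fin m → Fin m → Set) →
              (∀ {u v} → T (X u v) → P u v) → P p q → ∀ {u v} → T (insert X p q u v) → P u v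
insert-elim X P old new uv∈ with insert-cases {X = X} uv∈
... | inj₁ uv∈X          = old uv∈X
... | inj₂ (refl , refl) = new

pairsIn : ∀ {m} → Subset m → PairSet m
pairsIn S u v = does (u ∈? S) ∧ does (v ∈? S)

ordered? : ∀ {m} (e : Fin m × Fin m) → Dec (proj₁ e Fin.< proj₂ e)
ordered? e = proj₁ e FinP.<? proj₂ e

adjacent? : (G : Graph) (e : Fin (n G) × Fin (n G)) → Dec (Adj G (proj₁ e) (proj₂ e))
adjacent? G e = T? (adj G (proj₁ e) (proj₂ e))

isEdge : (G : Graph) → PairSet (n G)
isEdge G u v = does (u FinP.<? v) ∧ adj G u v

module FiniteSums (R : Semiring 0ℓ 0ℓ) where
  open Semiring R using (_≈_; setoid; +-cong; +-congˡ; +-identityˡ; +-identityʳ; +-assoc)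
    renaming (Carrier to C; _+_ to _⊕_; 0# to 0#)
  open import Relation.Binary.Bundles using (Setoid)
  open Setoid setoid using (reflexive) renaming (refl to ≈-refl; sym to ≈-sym; trans to ≈-trans)
  open import Relation.Binary.Reasoning.Setoid setoid
  open import Algebra.Properties.Semiring.Sum R public

  ∑L : List C → C
  ∑L = foldr _⊕_ 0#

  ∑L-++ : ∀ xs ys → ∑L (xs ++ ys) ≈ ∑L xs ⊕ ∑L ys
  ∑L-++ []       ys = ≈-sym (+-identityˡ _)
  ∑L-++ (x ∷ xs) ys = ≈-trans (+-congˡ (∑L-++ xs ys)) (≈-sym (+-assoc x _ _))

  ∑L-filter : ∀ {A : Set} {P : A → Set} (P? : ∀ x → Dec (P x)) (f : A → C) xs →
              ∑L (map f (filter P? xs)) ≈ ∑L (map (λ x → if does (P? x) then f x else 0#) xs)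
  ∑L-filter P? f []       = ≈-refl
  ∑L-filter P? f (x ∷ xs) with does (P? x)
  ... | true  = +-congˡ (∑L-filter P? f xs)
  ... | false = ≈-trans (∑L-filter P? f xs) (≈-sym (+-identityˡ _))

  ∑L-cartesianProduct : ∀ {A B : Set} (f : A × B → C) xs ys →
    ∑L (map f (cartesianProduct xs ys)) ≈ ∑L (map (λ x → ∑L (map (λ y → f (x , y)) ys)) xs)
  ∑L-cartesianProduct f []       ys = ≈-refl
  ∑L-cartesianProduct f (x ∷ xs) ys = begin
    ∑L (map f (map (x ,_) ys ++ cartesianProduct xs ys))
      ≡⟨ cong ∑L (ListP.map-++ f (map (x ,_) ys) _) ⟩
    ∑L (map f (map (x ,_) ys) ++ map f (cartesianProduct xs ys))
      ≈⟨ ∑L-++ (map f (map (x ,_) ys)) _ ⟩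
    ∑L (map f (map (x ,_) ys)) ⊕ ∑L (map f (cartesianProduct xs ys))
      ≈⟨ +-cong (reflexive (cong ∑L (sym (ListP.map-∘ ys)))) (∑L-cartesianProduct f xs ys) ⟩
    ∑L (map (λ y → f (x , y)) ys) ⊕ ∑L (map (λ x → ∑L (map (λ y → f (x , y)) ys)) xs) ∎

  ∑L-allFin : ∀ {m} (h : Fin m → C) → ∑L (map h (allFin m)) ≡ sum h
  ∑L-allFin h = trans (cong ∑L (ListP.map-tabulate id h)) (∑L-tabulate h)
    where
    ∑L-tabulate : ∀ {m} (h : Fin m → C) → ∑L (tabulate h) ≡ sum h
    ∑L-tabulate {zero}  h = refl
    ∑L-tabulate {suc m} h = cong (h zero ⊕_) (∑L-tabulate (h ∘ suc))

  ∑L-allPairs : ∀ {m} (f : Fin m × Fin m → C) →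
                ∑L (map f (cartesianProduct (allFin m) (allFin m))) ≈ sum λ u → sum λ v → f (u , v)
  ∑L-allPairs {m} f = ≈-trans (∑L-cartesianProduct f (allFin m) (allFin m))
    (reflexive (trans (cong ∑L (ListP.map-cong (λ u → ∑L-allFin (λ v → f (u , v))) (allFin m)))
                      (∑L-allFin (λ u → sum λ v → f (u , v)))))

  sum-pick : ∀ {m} (a : Fin m) (f : Fin m → C) → sum (λ x → if x ≟ a then f x else 0#) ≈ f a
  sum-pick {suc m} zero    f = ≈-trans (+-congˡ (sum-replicate-zero m)) (+-identityʳ _)
  sum-pick {suc m} (suc a) f = ≈-trans (+-identityˡ _) (sum-pick a (f ∘ suc))

  if-∧ : ∀ a b (x : C) → (if a then (if b then x else 0#) else 0#) ≈ (if a ∧ b then x else 0#)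
  if-∧ false b x = ≈-refl
  if-∧ true  b x = ≈-refl

  weigh : ∀ {m} → (Fin m → Fin m → C) → PairSet m → C
  weigh f X = sum λ u → sum λ v → if X u v then f u v else 0#

  weigh-cong : ∀ {m} (f : Fin m → Fin m → C) {X Y : PairSet m} → (∀ u v → X u v ≡ Y u v) → weigh f X ≈ weigh f Y
  weigh-cong f X≡Y = reflexive (sum-cong-≗ λ u → sum-cong-≗ λ v → cong (λ b → if b then f u v else 0#) (X≡Y u v))

  weigh-empty : ∀ {m} (f : Fin m → Fin m → C) → weigh f (λ _ _ → false) ≈ 0#
  weigh-empty {m} f =
    ≈-trans (sum-cong-≋ {m} {x = λ _ → sum {m} λ _ → 0#} (λ _ → sum-replicate-zero m)) (sum-replicate-zero m)

  weigh-insert : ∀ {m} (f : Fin m → Fin m → C) (X : PairSet m) {p q} → ¬ T (X p q) →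
                 weigh f (insert X p q) ≈ weigh f X ⊕ f p q
  weigh-insert {m} f X {p} {q} pq∉X = begin
    sum (λ u → sum λ v → if X u v ∨ (u ≟ p ∧ v ≟ q) then f u v else 0#)
      ≈⟨ sum-cong-≋ (λ u → sum-cong-≋ (λ v → split u v)) ⟩
    sum (λ u → sum λ v → old u v ⊕ new u v)
      ≈⟨ sum-cong-≋ (λ u → ∑-distrib-+ (old u) (new u)) ⟩
    sum (λ u → sum (old u) ⊕ sum (new u))
      ≈⟨ ∑-distrib-+ (λ u → sum (old u)) (λ u → sum (new u)) ⟩
    weigh f X ⊕ sum (λ u → sum (new u))
      ≈⟨ +-congˡ (≈-trans (sum-cong-≋ row) (sum-pick p (λ u → f u q))) ⟩
    weigh f X ⊕ f p q ∎
    where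
    old new : Fin m → Fin m → C
    old u v = if X u v then f u v else 0#
    new u v = if u ≟ p ∧ v ≟ q then f u v else 0#
    split : ∀ u v → (if X u v ∨ (u ≟ p ∧ v ≟ q) then f u v else 0#) ≈ old u v ⊕ new u v
    split u v with X u v in x | u FinP.≟ p | v FinP.≟ q
    ... | true  | yes refl | yes refl = ⊥-elim (pq∉X (subst T (sym x) _))
    ... | true  | yes _    | no _     = ≈-sym (+-identityʳ _)
    ... | true  | no _     | _        = ≈-sym (+-identityʳ _)
    ... | false | _        | _        = ≈-sym (+-identityˡ _)
    row : ∀ u → sum (new u) ≈ (if u ≟ p then f u q else 0#)
    row u with u ≟ p
    ... | true  = sum-pick q (f u)
    ... | false = sum-replicate-zero m

  module _ (G : Graph) where

    ∑L-edges : (f : Fin (n G) × Fin (n G) → C) → ∑L (map f (edges G)) ≈ weigh (λ u v → f (u , v)) (isEdge G)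
    ∑L-edges f = ≈-trans (∑L-filter (adjacent? G) f (pairs (n G)))
                (≈-trans (∑L-filter ordered? _ (cartesianProduct (allFin (n G)) (allFin (n G))))
                (≈-trans (∑L-allPairs {n G} _) (sum-cong-≋ λ u → sum-cong-≋ λ v → edge u v)))
      where
      edge : ∀ u v → (if does (u FinP.<? v) then (if does (T? (adj G u v)) then f (u , v) else 0#) else 0#)
                     ≈ (if isEdge G u v then f (u , v) else 0#)
      edge u v rewrite does-T? (adj G u v) = if-∧ (does (u FinP.<? v)) (adj G u v) (f (u , v))

    ∑L-filter-edges : ∀ {P : Fin (n G) × Fin (n G) → Set} (P? : ∀ e → Dec (P e)) (f : Fin (n G) × Fin (n G) → C) →
      ∑L (map f (filter P? (edges G))) ≈ weigh (λ u v → f (u , v)) (isEdge G ∧₂ λ u v → does (P? (u , v)))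
    ∑L-filter-edges P? f = ≈-trans (∑L-filter P? f (edges G))
      (≈-trans (∑L-edges _) (sum-cong-≋ λ u → sum-cong-≋ λ v → if-∧ (isEdge G u v) (does (P? (u , v))) (f (u , v))))

module ℕSums = FiniteSums ℕP.+-*-semiring
module ℚSums = FiniteSums (Ring.semiring ℚP.+-*-ring)

∑ : ∀ {m} → (Fin m → ℕ) → ℕ
∑ = ℕSums.sum

∑ℚ : ∀ {m} → (Fin m → ℚ) → ℚ
∑ℚ = ℚSums.sum

∑-cong : ∀ {m} {f g : Fin m → ℕ} → (∀ i → f i ≡ g i) → ∑ f ≡ ∑ g
∑-cong = ℕSums.sum-cong-≗

∑-mono-≤ : ∀ {m} {f g : Fin m → ℕ} → (∀ i → f i ℕ.≤ g i) → ∑ f ℕ.≤ ∑ g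
∑-mono-≤ {zero}  _   = z≤n
∑-mono-≤ {suc m} f≤g = ℕP.+-mono-≤ (f≤g zero) (∑-mono-≤ (f≤g ∘ suc))

∑-const-1 : ∀ m → ∑ {m} (λ _ → 1) ≡ m
∑-const-1 zero    = refl
∑-const-1 (suc m) = cong suc (∑-const-1 m)

∑-δ : ∀ {m} (a : Fin m) → ∑ (λ x → 𝟙 (x ≟ a)) ≡ 1
∑-δ a = ℕSums.sum-pick a (λ _ → 1)

term≤∑ : ∀ {m} (f : Fin m → ℕ) i → f i ℕ.≤ ∑ f
term≤∑ f zero    = ℕP.m≤m+n _ _
term≤∑ f (suc i) = ℕP.≤-trans (term≤∑ (f ∘ suc) i) (ℕP.m≤n+m _ _)

∑-pos⇒term-pos : ∀ {m} (f : Fin m → ℕ) → 0 ℕ.< ∑ f → ∃ λ i → 0 ℕ.< f i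
∑-pos⇒term-pos {suc m} f ∑f>0 with f zero in eq
... | suc _ = zero , subst (0 ℕ.<_) (sym eq) (s≤s z≤n)
... | zero  = let i , fi>0 = ∑-pos⇒term-pos (f ∘ suc) ∑f>0 in suc i , fi>0

∑ℚ-mono-≤ : ∀ {m} {f g : Fin m → ℚ} → (∀ i → f i ℚ.≤ g i) → ∑ℚ f ℚ.≤ ∑ℚ g
∑ℚ-mono-≤ {zero}  _   = ℚP.≤-refl
∑ℚ-mono-≤ {suc m} f≤g = ℚP.+-mono-≤ (f≤g zero) (∑ℚ-mono-≤ (f≤g ∘ suc))

∑ℚ-nonNeg : ∀ {m} {f : Fin m → ℚ} → (∀ i → ℚ.0ℚ ℚ.≤ f i) → ℚ.0ℚ ℚ.≤ ∑ℚ f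
∑ℚ-nonNeg {m} {f} f≥0 = subst (ℚ._≤ ∑ℚ f) (ℚSums.sum-replicate-zero m) (∑ℚ-mono-≤ f≥0)

term≤∑ℚ : ∀ {m} (f : Fin m → ℚ) → (∀ i → ℚ.0ℚ ℚ.≤ f i) → ∀ i → f i ℚ.≤ ∑ℚ f
term≤∑ℚ f f≥0 i = subst (ℚ._≤ ∑ℚ f) (ℚSums.sum-pick i f) (∑ℚ-mono-≤ picked≤)
  where
  picked≤ : ∀ x → (if x ≟ i then f x else ℚ.0ℚ) ℚ.≤ f x
  picked≤ x with x ≟ i
  ... | true  = ℚP.≤-refl
  ... | false = f≥0 x

#₂ : ∀ {m} → PairSet m → ℕ
#₂ = ℕSums.weigh (λ _ _ → 1)

weight : ∀ {m} → (Fin m → Fin m → ℚ) → PairSet m → ℚ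
weight = ℚSums.weigh

#₂-cong : ∀ {m} {X Y : PairSet m} → (∀ u v → X u v ≡ Y u v) → #₂ X ≡ #₂ Y
#₂-cong = ℕSums.weigh-cong (λ _ _ → 1)

weight-cong : ∀ {m} (ω : Fin m → Fin m → ℚ) {X Y : PairSet m} → (∀ u v → X u v ≡ Y u v) →
              weight ω X ≡ weight ω Y
weight-cong = ℚSums.weigh-cong

#₂-empty : ∀ m → #₂ {m} (λ _ _ → false) ≡ 0
#₂-empty m = ℕSums.weigh-empty {m} (λ _ _ → 1)

weight-empty : ∀ m (ω : Fin m → Fin m → ℚ) → weight ω (λ _ _ → false) ≡ ℚ.0ℚ
weight-empty m ω = ℚSums.weigh-empty {m} ω

#₂-insert : ∀ {m} (X : PairSet m) {p q} → ¬ T (X p q) → #₂ (insert X p q) ≡ #₂ X + 1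
#₂-insert = ℕSums.weigh-insert (λ _ _ → 1)

weight-insert : ∀ {m} (ω : Fin m → Fin m → ℚ) (X : PairSet m) {p q} → ¬ T (X p q) →
                weight ω (insert X p q) ≡ weight ω X ℚ.+ ω p q
weight-insert = ℚSums.weigh-insert

#₂-mono : ∀ {m} {X Y : PairSet m} → X ⊆₂ Y → #₂ X ℕ.≤ #₂ Y
#₂-mono {X = X} {Y} X⊆Y = ∑-mono-≤ λ u → ∑-mono-≤ λ v → 𝟙-mono {X u v} {Y u v} X⊆Y

member⇒#₂-pos : ∀ {m} (X : PairSet m) {u v} → T (X u v) → 0 ℕ.< #₂ X
member⇒#₂-pos X {u} {v} uv∈X = ℕP.≤-trans (𝟙-mono {true} (λ _ → uv∈X))
  (ℕP.≤-trans (term≤∑ (λ v → 𝟙 (X u v)) v) (term≤∑ (λ u → ∑ λ v → 𝟙 (X u v)) u))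

#₂-pos⇒member : ∀ {m} (X : PairSet m) → 0 ℕ.< #₂ X → ∃₂ λ u v → T (X u v)
#₂-pos⇒member X #X>0 =
  let u , row>0 = ∑-pos⇒term-pos _ #X>0
      v , 𝟙>0   = ∑-pos⇒term-pos _ row>0
  in u , v , 𝟙-pos 𝟙>0
  where
  𝟙-pos : ∀ {b} → 0 ℕ.< 𝟙 b → T b
  𝟙-pos {true} _ = _

weight-term : ∀ {m} (ω : Fin m → Fin m → ℚ) (X : PairSet m) → (∀ u v → T (X u v) → ℚ.0ℚ ℚ.≤ ω u v) →
              ∀ {u v} → T (X u v) → ω u v ℚ.≤ weight ω X
weight-term ω X ω≥0 {u} {v} uv∈X = subst (ℚ._≤ weight ω X) term≡ (ℚP.≤-trans
  (term≤∑ℚ (term u) (term≥0 u) v) (term≤∑ℚ (λ u → ∑ℚ (term u)) (λ u → ∑ℚ-nonNeg (term≥0 u)) u))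
  where
  term : _ → _ → ℚ
  term u v = if X u v then ω u v else ℚ.0ℚ
  term≥0 : ∀ u v → ℚ.0ℚ ℚ.≤ term u v
  term≥0 u v with X u v in x
  ... | true  = ω≥0 u v (subst T (sym x) _)
  ... | false = ℚP.≤-refl
  term≡ : term u v ≡ ω u v
  term≡ rewrite Equivalence.to BoolP.T-≡ uv∈X = refl

ℕtoℚ≡mkℚ : ∀ k → ℕtoℚ k ≡ ℚ.mkℚ (ℤ.+ k) 0 (Coprime.sym (Coprime.1-coprimeTo k))
ℕtoℚ≡mkℚ k = ℚP.normalize-coprime (Coprime.sym (Coprime.1-coprimeTo k))

ℕtoℚ-suc : ∀ k → ℕtoℚ (suc k) ≡ ℚ.1ℚ ℚ.+ ℕtoℚ k
ℕtoℚ-suc k = trans (cong (λ z → (ℤ.+ 1 ℤ.+ z) ℚ./ 1) (sym (ℤP.*-identityʳ (ℤ.+ k))))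
                   (cong₂ ℚ._+_ (sym (ℕtoℚ≡mkℚ 1)) (sym (ℕtoℚ≡mkℚ k)))

ℕtoℚ-+ : ∀ a b → ℕtoℚ (a + b) ≡ ℕtoℚ a ℚ.+ ℕtoℚ b
ℕtoℚ-+ zero    b = sym (ℚP.+-identityˡ (ℕtoℚ b))
ℕtoℚ-+ (suc a) b = begin
  ℕtoℚ (suc (a + b))             ≡⟨ ℕtoℚ-suc (a + b) ⟩
  ℚ.1ℚ ℚ.+ ℕtoℚ (a + b)          ≡⟨ cong (ℚ.1ℚ ℚ.+_) (ℕtoℚ-+ a b) ⟩
  ℚ.1ℚ ℚ.+ (ℕtoℚ a ℚ.+ ℕtoℚ b)  ≡⟨ sym (ℚP.+-assoc ℚ.1ℚ (ℕtoℚ a) (ℕtoℚ b)) ⟩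
  (ℚ.1ℚ ℚ.+ ℕtoℚ a) ℚ.+ ℕtoℚ b  ≡⟨ cong (ℚ._+ ℕtoℚ b) (sym (ℕtoℚ-suc a)) ⟩
  ℕtoℚ (suc a) ℚ.+ ℕtoℚ b       ∎
  where open ≡-Reasoning

ℕtoℚ-mono-≤ : ∀ {a b} → a ℕ.≤ b → ℕtoℚ a ℚ.≤ ℕtoℚ b
ℕtoℚ-mono-≤ {a} {b} a≤b rewrite ℕtoℚ≡mkℚ a | ℕtoℚ≡mkℚ b =
  ℚ.*≤* (subst₂ ℤ._≤_ (sym (ℤP.*-identityʳ (ℤ.+ a))) (sym (ℤP.*-identityʳ (ℤ.+ b))) (ℤ.+≤+ a≤b))

ℕtoℚ-mono-< : ∀ {a b} → a ℕ.< b → ℕtoℚ a ℚ.< ℕtoℚ b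
ℕtoℚ-mono-< {a} {b} a<b rewrite ℕtoℚ≡mkℚ a | ℕtoℚ≡mkℚ b =
  ℚ.*<* (subst₂ ℤ._<_ (sym (ℤP.*-identityʳ (ℤ.+ a))) (sym (ℤP.*-identityʳ (ℤ.+ b))) (ℤ.+<+ a<b))

0≤ℕtoℚ : ∀ a → ℚ.0ℚ ℚ.≤ ℕtoℚ a
0≤ℕtoℚ a = ℕtoℚ-mono-≤ {0} {a} z≤n

ℕtoℚ-∑ : ∀ {m} (f : Fin m → ℕ) → ℕtoℚ (∑ f) ≡ ∑ℚ (ℕtoℚ ∘ f)
ℕtoℚ-∑ {zero}  f = refl
ℕtoℚ-∑ {suc m} f = trans (ℕtoℚ-+ (f zero) _) (cong (ℕtoℚ (f zero) ℚ.+_) (ℕtoℚ-∑ (f ∘ suc)))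

weight-indicator : ∀ {m} (X Y : PairSet m) →
                   weight (λ u v → if Y u v then ℚ.1ℚ else ℚ.0ℚ) X ≡ ℕtoℚ (#₂ (X ∧₂ Y))
weight-indicator X Y = sym (trans (ℕtoℚ-∑ (λ u → ∑ λ v → 𝟙 (X u v ∧ Y u v)))
  (ℚSums.sum-cong-≗ λ u → trans (ℕtoℚ-∑ (λ v → 𝟙 (X u v ∧ Y u v)))
                                (ℚSums.sum-cong-≗ λ v → cases (X u v) (Y u v))))
  where
  cases : ∀ x y → ℕtoℚ (𝟙 (x ∧ y)) ≡ (if x then (if y then ℚ.1ℚ else ℚ.0ℚ) else ℚ.0ℚ)
  cases false y     = refl
  cases true  true  = refl
  cases true  false = refl

0≤+ : ∀ {p q} → ℚ.0ℚ ℚ.≤ p → ℚ.0ℚ ℚ.≤ q → ℚ.0ℚ ℚ.≤ p ℚ.+ q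
0≤+ = ℚP.+-mono-≤

0≤* : ∀ {p q} → ℚ.0ℚ ℚ.≤ p → ℚ.0ℚ ℚ.≤ q → ℚ.0ℚ ℚ.≤ p ℚ.* q
0≤* {p} {q} p≥0 q≥0 = subst (ℚ._≤ p ℚ.* q) (ℚP.*-zeroˡ q) (ℚP.*-monoʳ-≤-nonNeg q {{ℚ.nonNegative q≥0}} p≥0)

≤⇒0≤- : ∀ {p q} → p ℚ.≤ q → ℚ.0ℚ ℚ.≤ q ℚ.- p
≤⇒0≤- {p} {q} p≤q = subst (ℚ._≤ q ℚ.- p) (ℚP.+-inverseʳ p) (ℚP.+-monoˡ-≤ (ℚ.- p) p≤q)

0≤-⇒≤ : ∀ {p q} → ℚ.0ℚ ℚ.≤ q ℚ.- p → p ℚ.≤ q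
0≤-⇒≤ {p} {q} 0≤q-p = subst₂ ℚ._≤_ (ℚP.+-identityˡ p) q-p+p≡q (ℚP.+-monoˡ-≤ p 0≤q-p)
  where
  q-p+p≡q : (q ℚ.- p) ℚ.+ p ≡ q
  q-p+p≡q = ℚSolver.+-*-Solver.solve 2 (λ p q → (q :- p) :+ p := q) refl p q

≤∧≢⇒< : ∀ {p q} → p ℚ.≤ q → p ≢ q → p ℚ.< q
≤∧≢⇒< {p} {q} p≤q p≢q with ℚP.<-cmp p q
... | tri< p<q _ _ = p<q
... | tri≈ _ p≡q _ = ⊥-elim (p≢q p≡q)
... | tri> _ _ q<p = ⊥-elim (ℚP.<-irrefl refl (ℚP.<-≤-trans q<p p≤q))

divQ-*ʳ : ∀ p q → q ≢ ℚ.0ℚ → divQ p q ℚ.* q ≡ p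
divQ-*ʳ p q q≢0 with q ℚ.≟ ℚ.0ℚ
... | yes q≡0  = ⊥-elim (q≢0 q≡0)
... | no  q≢0′ = begin
  p ℚ.* ℚ.1/ q ℚ.* q     ≡⟨ ℚP.*-assoc p (ℚ.1/ q) q ⟩
  p ℚ.* (ℚ.1/ q ℚ.* q)   ≡⟨ cong (p ℚ.*_) (ℚP.*-inverseˡ q) ⟩
  p ℚ.* ℚ.1ℚ             ≡⟨ ℚP.*-identityʳ p ⟩
  p                      ∎
  where
  open ≡-Reasoning
  instance
    q-nonZero : ℚ.NonZero q
    q-nonZero = ℚ.≢-nonZero q≢0′

≤-divQ : ∀ {m p q} → ℚ.0ℚ ℚ.< q → m ℚ.* q ℚ.≤ p → m ℚ.≤ divQ p q
≤-divQ {m} {p} {q} q>0 m*q≤p = ℚP.*-cancelʳ-≤-pos q {{ℚ.positive q>0}}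
  (subst (m ℚ.* q ℚ.≤_) (sym (divQ-*ʳ p q (≢-sym (ℚP.<⇒≢ q>0)))) m*q≤p)

module _ {A : Set} where

  Reach-++ : ∀ {R : A → A → Set} {x y z} → Reach R x y → Reach R y z → Reach R x z
  Reach-++ here       q = q
  Reach-++ (step r p) q = step r (Reach-++ p q)

  Reach-map : ∀ {R S : A → A → Set} → (∀ {a b} → R a b → S a b) → ∀ {x y} → Reach R x y → Reach S x y
  Reach-map f here       = here
  Reach-map f (step r p) = step (f r) (Reach-map f p)

  Reach-restrict : ∀ {R : A → A → Set} (Q : A → Set) → (∀ {a b} → Q a → R a b → Q b) →
                   ∀ {x y} → Q x → Reach R x y → Reach (λ a b → Q a × Q b × R a b) x y
  Reach-restrict Q pres qx here       = here
  Reach-restrict Q pres qx (step r p) = step (qx , pres qx r , r) (Reach-restrict Q pres (pres qx r) p)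

  Reach-invariant : ∀ {B : Set} {R : A → A → Set} (f : A → B) → (∀ {a b} → R a b → f a ≡ f b) →
                    ∀ {x y} → Reach R x y → f x ≡ f y
  Reach-invariant f inv here       = refl
  Reach-invariant f inv (step r p) = trans (inv r) (Reach-invariant f inv p)

  Reach-first-step : ∀ {R : A → A → Set} {x y} → Reach R x y → x ≢ y → ∃ λ z → R x z
  Reach-first-step here       x≢x = ⊥-elim (x≢x refl)
  Reach-first-step (step r _) _   = _ , r

  data Last : List A → A → Set where
    [_] : ∀ y → Last (y ∷ []) y
    _∷_ : ∀ {y xs} x → Last xs y → Last (x ∷ xs) y

  Path : (A → A → Set) → A → A → Set
  Path R x y = Σ (List A) λ ws → Unique (x ∷ ws) × Linked R (x ∷ ws) × Last (x ∷ ws) y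

  private
    Unique-suffix : ∀ (pre : List A) {l} → Unique (pre ++ l) → Unique l
    Unique-suffix []        u       = u
    Unique-suffix (_ ∷ pre) (_ ∷ u) = Unique-suffix pre u

    Linked-suffix : ∀ {R : A → A → Set} pre {l} → Linked R (pre ++ l) → Linked R l
    Linked-suffix []        lk = lk
    Linked-suffix (_ ∷ pre) lk = Linked-suffix pre (Linked.tail lk)

    Last-suffix : ∀ pre {x post y} → Last (pre ++ x ∷ post) y → Last (x ∷ post) y
    Last-suffix []            l       = l
    Last-suffix (_ ∷ [])      (_ ∷ l) = l
    Last-suffix (_ ∷ p ∷ pre) (_ ∷ l) = Last-suffix (p ∷ pre) l

  Linked-snoc : ∀ {R : A → A → Set} {xs y z} → Linked R xs → Last xs y → R y z → Linked R (xs ++ z ∷ [])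
  Linked-snoc [-]       [ _ ]   r = r ∷ [-]
  Linked-snoc (r′ ∷ lk) (_ ∷ l) r = r′ ∷ Linked-snoc lk l r

  -- If x already lies on the path from b, the loop through x is cut off.
  walk⇒path : DecidableEquality A → ∀ {R : A → A → Set} {x y} → Reach R x y → Path R x y
  walk⇒path _≟A_ {x = x} here = [] , [] ∷ [] , [-] , [ x ]
  walk⇒path _≟A_ {R = R} {x} (step {b = b} r w) with walk⇒path _≟A_ w
  ... | ws , u , lk , l with Any.any? (x ≟A_) (b ∷ ws)
  ...   | no  x∉ = b ∷ ws , ¬Any⇒All¬ (b ∷ ws) x∉ ∷ u , r ∷ lk , x ∷ l
  ...   | yes x∈ with pre , post , eq ← ∈-∃++ x∈ =
          post , Unique-suffix pre (subst Unique eq u) , Linked-suffix pre (subst (Linked R) eq lk) ,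
          Last-suffix pre (subst (λ vs → Last vs _) eq l)

Adj-sym : ∀ (G : Graph) {a b} → Adj G a b → Adj G b a
Adj-sym G {a} {b} = subst T (Graph.sym G a b)

AdjF-mono : ∀ (G : Graph) {F F′ : EdgeSet G} → F ⊆₂ F′ → ∀ {a b} → AdjF G F a b → AdjF G F′ a b
AdjF-mono G F⊆F′ (inj₁ (lt , ab , f)) = inj₁ (lt , ab , F⊆F′ f)
AdjF-mono G F⊆F′ (inj₂ (gt , ba , f)) = inj₂ (gt , ba , F⊆F′ f)

isEdge⇒ : ∀ (G : Graph) {u v} → T (isEdge G u v) → u Fin.< v × Adj G u v
isEdge⇒ G {u} {v} e = let u<v , uv = T-∧⁻ (does (u FinP.<? v)) e in does-sound (u FinP.<? v) u<v , uv

⇒isEdge : ∀ (G : Graph) {u v} → u Fin.< v → Adj G u v → T (isEdge G u v)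
⇒isEdge G {u} {v} u<v uv rewrite dec-true (u FinP.<? v) u<v = uv

isEdge-nonNeg : ∀ (G : Graph) {ω : Weight G} → (∀ u v → u Fin.< v → Adj G u v → ℚ.0ℚ ℚ.≤ ω u v) →
                  ∀ {u v} → T (isEdge G u v) → ℚ.0ℚ ℚ.≤ ω u v
isEdge-nonNeg G ω≥0 e = let u<v , uv = isEdge⇒ G e in ω≥0 _ _ u<v uv

Adj⇒isEdge : ∀ (G : Graph) {a b} → Adj G a b → T (isEdge G a b) ⊎ T (isEdge G b a)
Adj⇒isEdge G {a} {b} ab with FinP.<-cmp a b
... | tri< a<b _ _  = inj₁ (⇒isEdge G a<b ab)
... | tri≈ _ refl _ = ⊥-elim (subst T (irrefl G a) ab)
... | tri> _ _ b<a  = inj₂ (⇒isEdge G b<a (Adj-sym G ab))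

∈-edges⁺ : ∀ (G : Graph) {u v} → T (isEdge G u v) → (u , v) ∈ₗ edges G
∈-edges⁺ G {u} {v} e = let u<v , uv = isEdge⇒ G e in
  ∈-filter⁺ (adjacent? G) (∈-filter⁺ ordered? (∈-cartesianProduct⁺ (∈-allFin u) (∈-allFin v)) u<v) uv

∈-edges⁻ : ∀ (G : Graph) {u v} → (u , v) ∈ₗ edges G → T (isEdge G u v)
∈-edges⁻ G uv∈ =
  let uv∈pairs , uv = ∈-filter⁻ (adjacent? G) uv∈
      _ , u<v = ∈-filter⁻ ordered? {xs = cartesianProduct (allFin (n G)) (allFin (n G))} uv∈pairs
  in ⇒isEdge G u<v uv

module _ (G : Graph) where

  eInduced≡#₂ : ∀ S → eInduced G S ≡ #₂ (isEdge G ∧₂ pairsIn S)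
  eInduced≡#₂ S = trans (length≡∑L (filter inS? (edges G))) (ℕSums.∑L-filter-edges G inS? (λ _ → 1))
    where
    inS? = λ (e : Fin (n G) × Fin (n G)) → (proj₁ e ∈? S) ×-dec (proj₂ e ∈? S)
    length≡∑L : ∀ {A : Set} (xs : List A) → length xs ≡ ℕSums.∑L (map (λ _ → 1) xs)
    length≡∑L []       = refl
    length≡∑L (x ∷ xs) = cong suc (length≡∑L xs)

  ωG≡weight : ∀ ω → ωG G ω ≡ weight ω (isEdge G)
  ωG≡weight ω = ℚSums.∑L-edges G _

  ωT≡weight : ∀ ω F → ωT G ω F ≡ weight ω (isEdge G ∧₂ F)
  ωT≡weight ω F = trans (ℚSums.∑L-filter-edges G _ _) (weight-cong ω λ u v → cong (isEdge G u v ∧_) (does-T? (F u v)))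

walk⇒cycle : ∀ (G : Graph) {F A′ : EdgeSet G} → A′ ⊆₂ F → ∀ {u v} → u Fin.< v → Adj G u v → T (F u v) →
             ¬ T (A′ u v) → Reach (AdjF G A′) u v → HasCycle G F
walk⇒cycle G A′⊆F {u} {v} u<v uv uv∈F uv∉A′ walk with walk⇒path FinP._≟_ walk
... | [] , _ , _ , [ _ ] = ⊥-elim (FinP.<-irrefl refl u<v)
... | _ ∷ [] , _ , inj₁ (_ , _ , uv∈A′) ∷ [-] , _ ∷ [ _ ] = ⊥-elim (uv∉A′ uv∈A′)
... | _ ∷ [] , _ , inj₂ (v<u , _ , _) ∷ [-] , _ ∷ [ _ ] = ⊥-elim (FinP.<-asym u<v v<u)
... | ws@(_ ∷ _ ∷ _) , unique , linked , last =
  u , ws , unique , s≤s (s≤s z≤n) , Linked-snoc (Linked.map (AdjF-mono G A′⊆F) linked) last (inj₂ (u<v , uv , uv∈F))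

∈⇒T : ∀ {m} {S : Subset m} {x} → x ∈ S → T (does (x ∈? S))
∈⇒T {S = S} {x} = does-complete (x ∈? S)

T⇒∈ : ∀ {m} {S : Subset m} {x} → T (does (x ∈? S)) → x ∈ S
T⇒∈ {S = S} {x} = does-sound (x ∈? S)

∈?-tabulate : ∀ {m} (f : Fin m → Bool) x → does (x ∈? Vec.tabulate f) ≡ f x
∈?-tabulate f zero    with f zero
... | true  = refl
... | false = refl
∈?-tabulate f (suc x) = ∈?-tabulate (f ∘ suc) x

∣S∣≡∑ : ∀ {m} (S : Subset m) → ∣ S ∣ ≡ ∑ λ x → 𝟙 (does (x ∈? S))
∣S∣≡∑ []          = refl
∣S∣≡∑ (true  ∷ S) = cong suc (∣S∣≡∑ S)
∣S∣≡∑ (false ∷ S) = ∣S∣≡∑ S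

two-members : ∀ {m} (S : Subset m) → 2 ℕ.≤ ∣ S ∣ → ∃₂ λ x y → x ≢ y × x ∈ S × y ∈ S
two-members (true  ∷ S) (s≤s 1≤∣S∣) =
  let y , y∈S = member S 1≤∣S∣ in zero , suc y , (λ ()) , Vec.here , Vec.there y∈S
  where
  member : ∀ {m} (S : Subset m) → 1 ℕ.≤ ∣ S ∣ → ∃ λ x → x ∈ S
  member (true  ∷ S) _      = zero , Vec.here
  member (false ∷ S) 1≤∣S∣ = let x , x∈S = member S 1≤∣S∣ in suc x , Vec.there x∈S
two-members (false ∷ S) 2≤∣S∣ =
  let x , y , x≢y , x∈S , y∈S = two-members S 2≤∣S∣
  in suc x , suc y , x≢y ∘ FinP.suc-injective , Vec.there x∈S , Vec.there y∈S

two-members⇒2≤∣S∣ : ∀ {m} {S : Subset m} {x y} → x ∈ S → y ∈ S → x ≢ y → 2 ℕ.≤ ∣ S ∣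
two-members⇒2≤∣S∣ {S = S} {x} {y} x∈S y∈S x≢y = ℕP.≤-trans
  (s≤s (subst (ℕ._≤ ∣ S - x ∣) (SubsetP.∣⁅x⁆∣≡1 y) (SubsetP.p⊆q⇒∣p∣≤∣q∣ ⁅y⁆⊆S-x)))
  (SubsetP.x∈p⇒∣p-x∣<∣p∣ x∈S)
  where
  ⁅y⁆⊆S-x : ⁅ y ⁆ ⊆ S - x
  ⁅y⁆⊆S-x z∈⁅y⁆ with refl ← SubsetP.x∈⁅y⁆⇒x≡y y z∈⁅y⁆ =
    SubsetP.x∈p∧x≢y⇒x∈p-y y∈S (≢-sym x≢y)

module _ (G : Graph) where

  induced-edge⇒2≤∣S∣ : ∀ S → 0 ℕ.< eInduced G S → 2 ℕ.≤ ∣ S ∣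
  induced-edge⇒2≤∣S∣ S e>0 with #₂-pos⇒member (isEdge G ∧₂ pairsIn S) (subst (0 ℕ.<_) (eInduced≡#₂ G S) e>0)
  ... | u , v , uv = let e , u∈v∈ = T-∧⁻ (isEdge G u v) uv ; u∈ , v∈ = T-∧⁻ (does (u ∈? S)) u∈v∈ in
    two-members⇒2≤∣S∣ (T⇒∈ u∈) (T⇒∈ v∈) (FinP.<⇒≢ (proj₁ (isEdge⇒ G e)))

  co₂⇒edge : ∀ {S} → InCo₂ G S → ∃₂ λ u v → T (isEdge G u v) × u ∈ S × v ∈ S
  co₂⇒edge {S} (connected , 2≤∣S∣) with two-members S 2≤∣S∣
  ... | x , y , x≢y , x∈S , y∈S with Reach-first-step (connected x y x∈S y∈S) x≢y
  ... | z , (_ , z∈S , xz) with Adj⇒isEdge G xz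
  ... | inj₁ e = x , z , e , x∈S , z∈S
  ... | inj₂ e = z , x , e , z∈S , x∈S

  co₂⇒eInduced-pos : ∀ {S} → InCo₂ G S → 0 ℕ.< eInduced G S
  co₂⇒eInduced-pos {S} co₂ with co₂⇒edge co₂
  ... | u , v , e , u∈S , v∈S = subst (0 ℕ.<_) (sym (eInduced≡#₂ G S))
    (member⇒#₂-pos (isEdge G ∧₂ pairsIn S) {u} {v} (T-∧⁺ e (T-∧⁺ (∈⇒T u∈S) (∈⇒T v∈S))))

  edge-co₂ : ∀ {u v} → Adj G u v → InCo₂ G (⁅ u ⁆ ∪ ⁅ v ⁆)
  edge-co₂ {u} {v} uv = connected , two-members⇒2≤∣S∣ u∈ v∈ u≢v
    where
    u≢v : u ≢ v
    u≢v refl = subst T (irrefl G u) uv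
    u∈ : u ∈ ⁅ u ⁆ ∪ ⁅ v ⁆
    u∈ = SubsetP.x∈p∪q⁺ (inj₁ (SubsetP.x∈⁅x⁆ u))
    v∈ : v ∈ ⁅ u ⁆ ∪ ⁅ v ⁆
    v∈ = SubsetP.x∈p∪q⁺ (inj₂ (SubsetP.x∈⁅x⁆ v))
    endpoint : ∀ {x} → x ∈ ⁅ u ⁆ ∪ ⁅ v ⁆ → x ≡ u ⊎ x ≡ v
    endpoint x∈ with SubsetP.x∈p∪q⁻ ⁅ u ⁆ ⁅ v ⁆ x∈
    ... | inj₁ x∈⁅u⁆ = inj₁ (SubsetP.x∈⁅y⁆⇒x≡y u x∈⁅u⁆)
    ... | inj₂ x∈⁅v⁆ = inj₂ (SubsetP.x∈⁅y⁆⇒x≡y v x∈⁅v⁆)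
    connected : InducedConnected G (⁅ u ⁆ ∪ ⁅ v ⁆)
    connected x y x∈ y∈ with endpoint x∈ | endpoint y∈
    ... | inj₁ refl | inj₁ refl = here
    ... | inj₂ refl | inj₂ refl = here
    ... | inj₁ refl | inj₂ refl = step (u∈ , v∈ , uv) here
    ... | inj₂ refl | inj₁ refl = step (v∈ , u∈ , Adj-sym G uv) here

-- Union–find

module UnionFind (G : Graph) (C : PairSet (n G)) where
  private
    N = n G
    V = Fin N

  -- cut u v certifies that the accepted edges form a forest: for an accepted uv it is a
  -- 2-colouring separating u from v and constant along every other accepted edge.
  record State : Set where
    constructor state
    field
      root      : V → V
      processed : PairSet N
      accepted  : PairSet N
      cut       : V → V → V → Bool
  open State public

  initial : State
  initial = state id (λ _ _ → false) (λ _ _ → false) (λ _ _ _ → false)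

  candidate : State → V → V → Bool
  candidate s p q = isEdge G p q ∧ C p q ∧ not (processed s p q)

  reject : State → V → V → State
  reject s p q = record s { processed = insert (processed s) p q }

  -- When q's component is attached below p's, every old cut is flipped on q's component
  -- if necessary, so that it still agrees at the ends p and q of the new edge.
  merge : State → V → V → State
  merge s p q = state root′ (insert (processed s) p q) (insert (accepted s) p q) cut′
    where
    root′ : V → V
    root′ x = if root s x ≟ root s q then root s p else root s x
    cut′ : V → V → V → Bool
    cut′ u v x = if u ≟ p ∧ v ≟ q then root s x ≟ root s p
                 else (cut s u v x xor (root s x ≟ root s q ∧ (cut s u v p xor cut s u v q)))

  join : State → V → V → State
  join s p q = if root s p ≟ root s q then reject s p q else merge s p q

  visit : State → V × V → State
  visit s (p , q) = if candidate s p q then join s p q else s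

  process : List (V × V) → State → State
  process []       s = s
  process (e ∷ es) s = process es (visit s e)

  #roots : State → ℕ
  #roots s = ∑ λ r → 𝟙 (root s r ≟ r)

  record Invariant (s : State) : Set where
    field
      root-idem          : ∀ x → root s (root s x) ≡ root s x
      processed⊆edges    : processed s ⊆₂ isEdge G
      processed⊆C        : processed s ⊆₂ C
      processed-root     : ∀ {u v} → T (processed s u v) → root s u ≡ root s v
      accepted⊆processed : accepted s ⊆₂ processed s
      root-reach         : ∀ {x y} → root s x ≡ root s y → Reach (AdjF G (accepted s)) x y
      roots+accepted     : #roots s + #₂ (accepted s) ≡ N
      cut-separates      : ∀ {u v} → T (accepted s u v) → cut s u v u ≢ cut s u v v
      cut-constant       : ∀ {u v x y} → T (accepted s u v) → T (accepted s x y) → ¬ (u ≡ x × v ≡ y) →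
                           cut s u v x ≡ cut s u v y

  initial-invariant : Invariant initial
  initial-invariant = record
    { root-idem          = λ _ → refl
    ; processed⊆edges    = λ ()
    ; processed⊆C        = λ ()
    ; processed-root     = λ ()
    ; accepted⊆processed = λ ()
    ; root-reach         = λ { refl → here }
    ; roots+accepted     = trans (cong₂ _+_ (trans (∑-cong {N} (cong 𝟙 ∘ ≟-refl)) (∑-const-1 N))
                                                (#₂-empty N))
                                  (ℕP.+-identityʳ N)
    ; cut-separates      = λ ()
    ; cut-constant       = λ ()
    }

  candidate⇒ : ∀ {s p q} → T (candidate s p q) → T (isEdge G p q) × T (C p q) × ¬ T (processed s p q)
  candidate⇒ {s} {p} {q} c =
    let e , rest = T-∧⁻ (isEdge G p q) c ; c′ , unprocessed = T-∧⁻ (C p q) rest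
    in e , c′ , subst T (Equivalence.to BoolP.T-not-≡ unprocessed)

  module _ {s : State} (I : Invariant s) {p q : V} (pq-candidate : T (candidate s p q)) where
    open Invariant I

    private
      pq-edge : T (isEdge G p q)
      pq-edge = proj₁ (candidate⇒ {s} {p} {q} pq-candidate)

      pq-C : T (C p q)
      pq-C = proj₁ (proj₂ (candidate⇒ {s} {p} {q} pq-candidate))

      pq-unprocessed : ¬ T (processed s p q)
      pq-unprocessed = proj₂ (proj₂ (candidate⇒ {s} {p} {q} pq-candidate))

    reject-invariant : root s p ≡ root s q → Invariant (reject s p q)
    reject-invariant rp≡rq = record
      { root-idem          = root-idem
      ; processed⊆edges    = insert-elim (processed s) (λ u v → T (isEdge G u v)) processed⊆edges pq-edge
      ; processed⊆C        = insert-elim (processed s) (λ u v → T (C u v)) processed⊆C pq-C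
      ; processed-root     = insert-elim (processed s) (λ u v → root s u ≡ root s v) processed-root rp≡rq
      ; accepted⊆processed = insert-⊇ (processed s) ∘ accepted⊆processed
      ; root-reach         = root-reach
      ; roots+accepted     = roots+accepted
      ; cut-separates      = cut-separates
      ; cut-constant       = cut-constant
      }

    module Merge (rp≢rq : root s p ≢ root s q) where
      private
        s′ = merge s p q
        root′ = root s′

        root-moved : ∀ {x} → root s x ≡ root s q → root′ x ≡ root s p
        root-moved rx≡rq = BoolP.if-cong (trans (cong (_≟ root s q) rx≡rq) (≟-refl (root s q)))

        root-kept : ∀ {x} → root s x ≢ root s q → root′ x ≡ root s x
        root-kept rx≢rq = BoolP.if-cong (≟-≢ rx≢rq)

        root-relinked : ∀ {x y} → root s x ≡ root s y → root′ x ≡ root′ y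
        root-relinked rx≡ry = cong (λ r → if r ≟ root s q then root s p else r) rx≡ry

        root-of-root-kept : ∀ {x} → root s x ≢ root s q → root s (root s x) ≢ root s q
        root-of-root-kept {x} rx≢rq e = rx≢rq (trans (sym (root-idem x)) e)

        accepted-same-root : ∀ {u v} → T (accepted s u v) → root s u ≡ root s v
        accepted-same-root = processed-root ∘ accepted⊆processed

        lift : ∀ {a b} → Reach (AdjF G (accepted s)) a b → Reach (AdjF G (accepted s′)) a b
        lift = Reach-map (AdjF-mono G (insert-⊇ (accepted s)))

        pq-accepted : p Fin.< q × Adj G p q × T (accepted s′ p q)
        pq-accepted = let p<q , pq = isEdge⇒ G pq-edge in p<q , pq , insert-new (accepted s) p q

        pq-unaccepted : ¬ T (accepted s p q)
        pq-unaccepted = pq-unprocessed ∘ accepted⊆processed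

        accepted-old : ∀ {u v} → T (accepted s u v) → ¬ (u ≡ p × v ≡ q)
        accepted-old uv∈ (refl , refl) = pq-unaccepted uv∈

      root-idem′ : ∀ x → root′ (root′ x) ≡ root′ x
      root-idem′ x = by-cases (root s x FinP.≟ root s q)
        where
        open ≡-Reasoning
        by-cases : Dec (root s x ≡ root s q) → root′ (root′ x) ≡ root′ x
        by-cases (yes rx≡rq) = begin
          root′ (root′ x)     ≡⟨ cong root′ (root-moved rx≡rq) ⟩
          root′ (root s p)    ≡⟨ root-kept (root-of-root-kept rp≢rq) ⟩
          root s (root s p)   ≡⟨ root-idem p ⟩
          root s p            ≡⟨ sym (root-moved rx≡rq) ⟩
          root′ x             ∎
        by-cases (no rx≢rq) = begin
          root′ (root′ x)     ≡⟨ cong root′ (root-kept rx≢rq) ⟩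
          root′ (root s x)    ≡⟨ root-kept (root-of-root-kept rx≢rq) ⟩
          root s (root s x)   ≡⟨ root-idem x ⟩
          root s x            ≡⟨ sym (root-kept rx≢rq) ⟩
          root′ x             ∎

      root-reach′ : ∀ {x y} → root′ x ≡ root′ y → Reach (AdjF G (accepted s′)) x y
      root-reach′ {x} {y} r′x≡r′y = by-cases (root s x FinP.≟ root s q) (root s y FinP.≟ root s q)
        where
        by-cases : Dec (root s x ≡ root s q) → Dec (root s y ≡ root s q) → Reach (AdjF G (accepted s′)) x y
        by-cases (yes rx≡rq) (yes ry≡rq) = lift (root-reach (trans rx≡rq (sym ry≡rq)))
        by-cases (no  rx≢rq) (no  ry≢rq) =
          lift (root-reach (trans (sym (root-kept rx≢rq)) (trans r′x≡r′y (root-kept ry≢rq))))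
        by-cases (yes rx≡rq) (no  ry≢rq) = Reach-++ (lift (root-reach rx≡rq))
          (step (inj₂ pq-accepted) (lift (root-reach (trans (sym (root-moved rx≡rq)) (trans r′x≡r′y (root-kept ry≢rq))))))
        by-cases (no  rx≢rq) (yes ry≡rq) =
          Reach-++ (lift (root-reach (trans (sym (root-kept rx≢rq)) (trans r′x≡r′y (root-moved ry≡rq)))))
                   (step (inj₁ pq-accepted) (lift (root-reach (sym ry≡rq))))

      roots-merge : #roots s′ + 1 ≡ #roots s
      roots-merge = begin
        #roots s′ + 1                                          ≡⟨ cong (#roots s′ +_) (sym (∑-δ (root s q))) ⟩
        #roots s′ + ∑ (λ r → 𝟙 (r ≟ root s q))                 ≡⟨ sym (ℕSums.∑-distrib-+ (λ r → 𝟙 (root′ r ≟ r)) _) ⟩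
        ∑ (λ r → 𝟙 (root′ r ≟ r) + 𝟙 (r ≟ root s q))           ≡⟨ ∑-cong pointwise ⟩
        #roots s                                               ∎
        where
        open ≡-Reasoning
        pointwise : ∀ r → 𝟙 (root′ r ≟ r) + 𝟙 (r ≟ root s q) ≡ 𝟙 (root s r ≟ r)
        pointwise r = by-cases (root s r FinP.≟ root s q) (r FinP.≟ root s q)
          where
          by-cases : Dec (root s r ≡ root s q) → Dec (r ≡ root s q) →
                     𝟙 (root′ r ≟ r) + 𝟙 (r ≟ root s q) ≡ 𝟙 (root s r ≟ r)
          by-cases (yes rr≡rq) (yes r≡rq) =
            trans (cong₂ _+_ (𝟙≟-no λ e → rp≢rq (trans (sym (root-moved rr≡rq)) (trans e r≡rq))) (𝟙≟-yes r≡rq))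
                  (sym (𝟙≟-yes (trans rr≡rq (sym r≡rq))))
          by-cases (yes rr≡rq) (no r≢rq) =
            trans (cong₂ _+_ (𝟙≟-no λ e → rr≢r (trans (cong (root s) (sym (trans (sym (root-moved rr≡rq)) e)))
                                                        (trans (root-idem p) (trans (sym (root-moved rr≡rq)) e))))
                             (𝟙≟-no r≢rq))
                  (sym (𝟙≟-no rr≢r))
            where
            rr≢r : root s r ≢ r
            rr≢r e = r≢rq (trans (sym e) rr≡rq)
          by-cases (no rr≢rq) (yes r≡rq) = ⊥-elim (rr≢rq (trans (cong (root s) r≡rq) (root-idem q)))
          by-cases (no rr≢rq) (no r≢rq) =
            trans (cong₂ _+_ (cong (λ z → 𝟙 (z ≟ r)) (root-kept rr≢rq)) (𝟙≟-no r≢rq)) (ℕP.+-identityʳ _)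

      roots+accepted′ : #roots s′ + #₂ (accepted s′) ≡ N
      roots+accepted′ = begin
        #roots s′ + #₂ (accepted s′)            ≡⟨ cong (#roots s′ +_) (#₂-insert (accepted s) pq-unaccepted) ⟩
        #roots s′ + (#₂ (accepted s) + 1)       ≡⟨ rearrange (#roots s′) (#₂ (accepted s)) ⟩
        (#roots s′ + 1) + #₂ (accepted s)       ≡⟨ cong (_+ #₂ (accepted s)) roots-merge ⟩
        #roots s + #₂ (accepted s)              ≡⟨ roots+accepted ⟩
        N                                       ∎
        where
        open ≡-Reasoning
        rearrange : ∀ a b → a + (b + 1) ≡ (a + 1) + b
        rearrange = solve-∀

      private
        flip-q : V → V → V → Bool
        flip-q u v x = root s x ≟ root s q ∧ (cut s u v p xor cut s u v q)

        cut-new : ∀ x → cut s′ p q x ≡ (root s x ≟ root s p)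
        cut-new x = BoolP.if-cong (cong₂ _∧_ (≟-refl p) (≟-refl q))

        cut-old : ∀ {u v} → ¬ (u ≡ p × v ≡ q) → ∀ x → cut s′ u v x ≡ (cut s u v x xor flip-q u v x)
        cut-old uv≢pq x = BoolP.if-cong (≟-pair-≢ uv≢pq)

        flip-q-root : ∀ {u v x y} → root s x ≡ root s y → flip-q u v x ≡ flip-q u v y
        flip-q-root {u} {v} rx≡ry = cong (λ r → r ≟ root s q ∧ (cut s u v p xor cut s u v q)) rx≡ry

      cut-separates′ : ∀ {u v} → T (accepted s′ u v) → cut s′ u v u ≢ cut s′ u v v
      cut-separates′ = insert-elim (accepted s) (λ u v → cut s′ u v u ≢ cut s′ u v v) old new
        where
        old : ∀ {u v} → T (accepted s u v) → cut s′ u v u ≢ cut s′ u v v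
        old {u} {v} uv∈ e = cut-separates uv∈ (xor-cancelʳ _ _ (flip-q u v u)
          (trans (sym (cut-old (accepted-old uv∈) u))
          (trans e (trans (cut-old (accepted-old uv∈) v) (cong (cut s u v v xor_) (flip-q-root (sym (accepted-same-root uv∈))))))))
        new : cut s′ p q p ≢ cut s′ p q q
        new e with () ← trans (sym (trans (cut-new p) (≟-refl (root s p))))
                              (trans e (trans (cut-new q) (≟-≢ (rp≢rq ∘ sym))))

      cut-constant′ : ∀ {u v x y} → T (accepted s′ u v) → T (accepted s′ x y) → ¬ (u ≡ x × v ≡ y) →
                      cut s′ u v x ≡ cut s′ u v y
      cut-constant′ {u} {v} uv∈ xy∈ uv≢xy with insert-cases {X = accepted s} uv∈ | insert-cases {X = accepted s} xy∈
      ... | inj₂ (refl , refl) | inj₂ (refl , refl) = ⊥-elim (uv≢xy (refl , refl))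
      ... | inj₂ (refl , refl) | inj₁ xy∈A =
        trans (cut-new _) (trans (cong (_≟ root s p) (accepted-same-root xy∈A)) (sym (cut-new _)))
      ... | inj₁ uv∈A | inj₂ (refl , refl) = begin
        cut s′ u v p                                      ≡⟨ cut-old (accepted-old uv∈A) p ⟩
        cut s u v p xor (root s p ≟ root s q ∧ D)         ≡⟨ cong (λ b → cut s u v p xor (b ∧ D)) (≟-≢ rp≢rq) ⟩
        cut s u v p xor false                             ≡⟨ BoolP.xor-identityʳ _ ⟩
        cut s u v p                                       ≡⟨ sym (xor-swap (cut s u v p) (cut s u v q)) ⟩
        cut s u v q xor D                                 ≡⟨ cong (λ b → cut s u v q xor (b ∧ D)) (sym (≟-refl (root s q))) ⟩
        cut s u v q xor (root s q ≟ root s q ∧ D)         ≡⟨ sym (cut-old (accepted-old uv∈A) q) ⟩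
        cut s′ u v q                                      ∎
        where
        open ≡-Reasoning
        D = cut s u v p xor cut s u v q
      ... | inj₁ uv∈A | inj₁ xy∈A =
        trans (cut-old (accepted-old uv∈A) _)
        (trans (cong₂ _xor_ (cut-constant uv∈A xy∈A uv≢xy) (flip-q-root (accepted-same-root xy∈A)))
        (sym (cut-old (accepted-old uv∈A) _)))

      merge-invariant : Invariant s′
      merge-invariant = record
        { root-idem          = root-idem′
        ; processed⊆edges    = insert-elim (processed s) (λ u v → T (isEdge G u v)) processed⊆edges pq-edge
        ; processed⊆C        = insert-elim (processed s) (λ u v → T (C u v)) processed⊆C pq-C
        ; processed-root     = insert-elim (processed s) (λ u v → root′ u ≡ root′ v) (root-relinked ∘ processed-root)
                                 (trans (root-kept rp≢rq) (sym (root-moved refl)))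
        ; accepted⊆processed = insert-elim (accepted s) (λ u v → T (processed s′ u v))
                                 (insert-⊇ (processed s) ∘ accepted⊆processed) (insert-new (processed s) p q)
        ; root-reach         = root-reach′
        ; roots+accepted     = roots+accepted′
        ; cut-separates      = cut-separates′
        ; cut-constant       = cut-constant′
        }

    join-invariant : Invariant (join s p q)
    join-invariant with root s p FinP.≟ root s q
    ... | yes rp≡rq = reject-invariant rp≡rq
    ... | no  rp≢rq = Merge.merge-invariant rp≢rq

  visit-invariant : ∀ {s} → Invariant s → ∀ e → Invariant (visit s e)
  visit-invariant {s} I (p , q) = by-cases (candidate s p q) refl
    where
    by-cases : ∀ b → candidate s p q ≡ b → Invariant (if b then join s p q else s)
    by-cases true  c = join-invariant I (subst T (sym c) _)
    by-cases false _ = I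

  process-invariant : ∀ {s} → Invariant s → ∀ es → Invariant (process es s)
  process-invariant I []       = I
  process-invariant I (e ∷ es) = process-invariant (visit-invariant I e) es

  processed-join : ∀ s p q → processed (join s p q) ≡ insert (processed s) p q
  processed-join s p q = by-cases (root s p ≟ root s q)
    where
    by-cases : ∀ b → processed (if b then reject s p q else merge s p q) ≡ insert (processed s) p q
    by-cases true  = refl
    by-cases false = refl

  visit-⊇ : ∀ s e → processed s ⊆₂ processed (visit s e)
  visit-⊇ s (p , q) = by-cases (candidate s p q)
    where
    by-cases : ∀ b → processed s ⊆₂ processed (if b then join s p q else s)
    by-cases true  uv∈ = subst (λ X → T (X _ _)) (sym (processed-join s p q)) (insert-⊇ (processed s) uv∈)
    by-cases false uv∈ = uv∈

  visit-visits : ∀ s {p q} → T (isEdge G p q) → T (C p q) → T (processed (visit s (p , q)) p q)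
  visit-visits s {p} {q} pq-edge pq-C = by-cases (candidate s p q) refl
    where
    by-cases : ∀ b → candidate s p q ≡ b → T (processed (if b then join s p q else s) p q)
    by-cases true  _ = subst (λ X → T (X p q)) (sym (processed-join s p q)) (insert-new (processed s) p q)
    by-cases false c with processed s p q
    ... | true  = _
    ... | false = ⊥-elim (subst T c (T-∧⁺ pq-edge (T-∧⁺ pq-C _)))

  process-⊇ : ∀ es s → processed s ⊆₂ processed (process es s)
  process-⊇ []       s = id
  process-⊇ (e ∷ es) s = process-⊇ es (visit s e) ∘ visit-⊇ s e

  Complete : State → Set
  Complete s = (isEdge G ∧₂ C) ⊆₂ processed s

  process-complete : ∀ es s → (∀ {u v} → T (isEdge G u v) → T (C u v) → (u , v) ∈ₗ es) → Complete (process es s)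
  process-complete es s covers {u} {v} uv = let e , c = T-∧⁻ (isEdge G u v) uv in go e c es s (covers e c)
    where
    go : T (isEdge G u v) → T (C u v) → ∀ es s → (u , v) ∈ₗ es → T (processed (process es s) u v)
    go e c (_ ∷ es) s (here refl) = process-⊇ es _ (visit-visits s e c)
    go e c (_ ∷ es) s (there uv∈) = go e c es _ uv∈

  module _ {s : State} (I : Invariant s) where
    open Invariant I

    accepted⊆edges : accepted s ⊆₂ isEdge G
    accepted⊆edges = processed⊆edges ∘ accepted⊆processed

    accepted⊆C : accepted s ⊆₂ C
    accepted⊆C = processed⊆C ∘ accepted⊆processed

    accepted-root : ∀ {a b} → AdjF G (accepted s) a b → root s a ≡ root s b
    accepted-root (inj₁ (_ , _ , ab∈)) = processed-root (accepted⊆processed ab∈)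
    accepted-root (inj₂ (_ , _ , ba∈)) = sym (processed-root (accepted⊆processed ba∈))

    complete⇒same-root : Complete s → ∀ {u v} → T (isEdge G u v) → T (C u v) → root s u ≡ root s v
    complete⇒same-root complete e c = processed-root (complete (T-∧⁺ e c))

    private
      cut-across : ∀ {a b} → AdjF G (accepted s) a b → V → Bool
      cut-across {a} {b} (inj₁ _) = cut s a b
      cut-across {a} {b} (inj₂ _) = cut s b a

      cut-across-separates : ∀ {a b} (r : AdjF G (accepted s) a b) → cut-across r a ≢ cut-across r b
      cut-across-separates (inj₁ (_ , _ , ab∈)) = cut-separates ab∈
      cut-across-separates (inj₂ (_ , _ , ba∈)) = cut-separates ba∈ ∘ sym

      Off : V → V → V → Set
      Off a b z = z ≢ a × z ≢ b

      same-ends : ∀ {a b x y} → Off a b x ⊎ Off a b y → ¬ ((x ≡ a × y ≡ b) ⊎ (x ≡ b × y ≡ a))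
      same-ends (inj₁ (x≢a , _)) (inj₁ (x≡a , _)) = x≢a x≡a
      same-ends (inj₁ (_ , x≢b)) (inj₂ (x≡b , _)) = x≢b x≡b
      same-ends (inj₂ (_ , y≢b)) (inj₁ (_ , y≡b)) = y≢b y≡b
      same-ends (inj₂ (y≢a , _)) (inj₂ (_ , y≡a)) = y≢a y≡a

      cut-across-constant : ∀ {a b x y} (r : AdjF G (accepted s) a b) → AdjF G (accepted s) x y →
                            Off a b x ⊎ Off a b y → cut-across r x ≡ cut-across r y
      cut-across-constant (inj₁ (_ , _ , ab∈)) (inj₁ (_ , _ , xy∈)) off =
        cut-constant ab∈ xy∈ λ (a≡x , b≡y) → same-ends off (inj₁ (sym a≡x , sym b≡y))
      cut-across-constant (inj₁ (_ , _ , ab∈)) (inj₂ (_ , _ , yx∈)) off =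
        sym (cut-constant ab∈ yx∈ λ (a≡y , b≡x) → same-ends off (inj₂ (sym b≡x , sym a≡y)))
      cut-across-constant (inj₂ (_ , _ , ba∈)) (inj₁ (_ , _ , xy∈)) off =
        cut-constant ba∈ xy∈ λ (b≡x , a≡y) → same-ends off (inj₂ (sym b≡x , sym a≡y))
      cut-across-constant (inj₂ (_ , _ , ba∈)) (inj₂ (_ , _ , yx∈)) off =
        sym (cut-constant ba∈ yx∈ λ (b≡y , a≡x) → same-ends off (inj₁ (sym a≡x , sym b≡y)))

      walk-constant : ∀ {a b} (r : AdjF G (accepted s) a b) {x} w ws → All (Off a b) (w ∷ ws) →
                      Linked (AdjF G (accepted s)) (x ∷ w ∷ ws ++ a ∷ []) → cut-across r x ≡ cut-across r a
      walk-constant r w []        (off ∷ [])   (xw ∷ wa ∷ [-]) =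
        trans (cut-across-constant r xw (inj₂ off)) (cut-across-constant r wa (inj₁ off))
      walk-constant r w (w′ ∷ ws) (off ∷ offs) (xw ∷ rest) =
        trans (cut-across-constant r xw (inj₂ off)) (walk-constant r w′ ws offs rest)

    accepted-acyclic : ¬ HasCycle G (accepted s)
    accepted-acyclic (_ , []     , _ , ()     , _)
    accepted-acyclic (_ , _ ∷ [] , _ , s≤s () , _)
    accepted-acyclic (v₀ , v₁ ∷ v₂ ∷ vs , (v₀∉ ∷ v₁∉ ∷ _) , _ , e₀₁ ∷ walk) =
      cut-across-separates e₀₁ (sym (walk-constant e₀₁ v₂ vs offs walk))
      where
      offs : All (Off v₀ v₁) (v₂ ∷ vs)
      offs = All.zipWith (λ (v₀≢ , v₁≢) → ≢-sym v₀≢ , ≢-sym v₁≢) (All.tail v₀∉ , v₁∉)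

module InducedComponents (G : Graph) (S : Subset (n G)) where
  open UnionFind G (pairsIn S)

  final : State
  final = process (edges G) initial

  final-invariant : Invariant final
  final-invariant = process-invariant initial-invariant (edges G)

  final-complete : Complete final
  final-complete = process-complete (edges G) initial (λ e _ → ∈-edges⁺ G e)

  inside-step⇒same-root : ∀ {a b} → a ∈ S × b ∈ S × Adj G a b → root final a ≡ root final b
  inside-step⇒same-root (a∈ , b∈ , ab) with Adj⇒isEdge G ab
  ... | inj₁ e = complete⇒same-root final-invariant final-complete e (T-∧⁺ (∈⇒T a∈) (∈⇒T b∈))
  ... | inj₂ e = sym (complete⇒same-root final-invariant final-complete e (T-∧⁺ (∈⇒T b∈) (∈⇒T a∈)))

  accepted-step⇒inside : ∀ {a b} → AdjF G (accepted final) a b → a ∈ S × b ∈ S × Adj G a b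
  accepted-step⇒inside {a} (inj₁ (_ , ab , ab∈)) =
    let a∈ , b∈ = T-∧⁻ (does (a ∈? S)) (accepted⊆C final-invariant ab∈) in T⇒∈ a∈ , T⇒∈ b∈ , ab
  accepted-step⇒inside {a} {b} (inj₂ (_ , ba , ba∈)) =
    let b∈ , a∈ = T-∧⁻ (does (b ∈? S)) (accepted⊆C final-invariant ba∈) in T⇒∈ a∈ , T⇒∈ b∈ , Adj-sym G ba

  connected⇔same-root : InducedConnected G S ⇔ (∀ u v → u ∈ S → v ∈ S → root final u ≡ root final v)
  connected⇔same-root = mk⇔
    (λ conn u v u∈ v∈ → Reach-invariant (root final) inside-step⇒same-root (conn u v u∈ v∈))
    (λ same u v u∈ v∈ → Reach-map accepted-step⇒inside (Invariant.root-reach final-invariant (same u v u∈ v∈)))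

InducedConnected? : ∀ (G : Graph) S → Dec (InducedConnected G S)
InducedConnected? G S = Dec.map (⇔.sym connected⇔same-root)
  (FinP.all? λ u → FinP.all? λ v → (u ∈? S) →-dec ((v ∈? S) →-dec (root final u FinP.≟ root final v)))
  where
  open InducedComponents G S
  open UnionFind G (pairsIn S) using (root)

InCo₂? : ∀ (G : Graph) S → Dec (InCo₂ G S)
InCo₂? G S = InducedConnected? G S ×-dec (2 ℕ.≤? ∣ S ∣)

-- Forests inside a set of vertices

#outside : ∀ {m} → Subset m → ℕ
#outside S = ∑ λ x → 𝟙 (not (does (x ∈? S)))

#outside+∣S∣ : ∀ {m} (S : Subset m) → #outside S + ∣ S ∣ ≡ m
#outside+∣S∣ {m} S = begin
  #outside S + ∣ S ∣                                        ≡⟨ cong (#outside S +_) (∣S∣≡∑ S) ⟩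
  #outside S + ∑ (λ x → 𝟙 (does (x ∈? S)))                   ≡⟨ sym (ℕSums.∑-distrib-+ _ (λ x → 𝟙 (does (x ∈? S)))) ⟩
  ∑ (λ x → 𝟙 (not (does (x ∈? S))) + 𝟙 (does (x ∈? S)))      ≡⟨ ∑-cong (λ x → 𝟙-not+𝟙 (does (x ∈? S))) ⟩
  ∑ {m} (λ _ → 1)                                           ≡⟨ ∑-const-1 m ⟩
  m                                                         ∎
  where
  open ≡-Reasoning
  𝟙-not+𝟙 : ∀ b → 𝟙 (not b) + 𝟙 b ≡ 1
  𝟙-not+𝟙 true  = refl
  𝟙-not+𝟙 false = refl

module ForestInside (G : Graph) (F : EdgeSet G) (F-acyclic : ¬ HasCycle G F) (S : Subset (n G)) where
  open UnionFind G (F ∧₂ pairsIn S)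

  private
    final : State
    final = process (edges G) initial

    I : Invariant final
    I = process-invariant initial-invariant (edges G)

    open Invariant I

    accepted⊆F : accepted final ⊆₂ F
    accepted⊆F {u} {v} = proj₁ ∘ T-∧⁻ (F u v) ∘ accepted⊆C I

    accepted-source-inside : ∀ {a b} → AdjF G (accepted final) a b → a ∈ S
    accepted-source-inside {a} {b} (inj₁ (_ , _ , ab∈)) =
      T⇒∈ (proj₁ (T-∧⁻ (does (a ∈? S)) (proj₂ (T-∧⁻ (F a b) (accepted⊆C I ab∈)))))
    accepted-source-inside {a} {b} (inj₂ (_ , _ , ba∈)) =
      T⇒∈ (proj₂ (T-∧⁻ (does (b ∈? S)) (proj₂ (T-∧⁻ (F b a) (accepted⊆C I ba∈)))))

    outside-is-root : ∀ {x} → x ∉ S → root final x ≡ x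
    outside-is-root {x} x∉S with root final x FinP.≟ x
    ... | yes rx≡x = rx≡x
    ... | no  rx≢x =
      ⊥-elim (x∉S (accepted-source-inside (proj₂ (Reach-first-step (root-reach (sym (root-idem x))) (rx≢x ∘ sym)))))

    root-inside : ∀ {x} → x ∈ S → root final x ∈ S
    root-inside {x} x∈S with root final x FinP.≟ x
    ... | yes rx≡x = subst (_∈ S) (sym rx≡x) x∈S
    ... | no  rx≢x = accepted-source-inside (proj₂ (Reach-first-step (root-reach (root-idem x)) rx≢x))

    -- An unaccepted edge of F inside S would close a cycle with accepted edges, which lie in F.
    F-edges-accepted : (isEdge G ∧₂ (F ∧₂ pairsIn S)) ⊆₂ accepted final
    F-edges-accepted {u} {v} uv with accepted final u v in uv∈?
    ... | true  = _
    ... | false =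
      let e , c = T-∧⁻ (isEdge G u v) uv
          u<v , adj-uv = isEdge⇒ G e
          walk = root-reach (complete⇒same-root I (process-complete (edges G) initial (λ e _ → ∈-edges⁺ G e)) e c)
      in ⊥-elim (F-acyclic (walk⇒cycle G accepted⊆F u<v adj-uv (proj₁ (T-∧⁻ (F u v) c)) (subst T uv∈?) walk))

    #roots-outside : ∀ {s₀} → s₀ ∈ S → #outside S + 1 ℕ.≤ #roots final
    #roots-outside {s₀} s₀∈S = begin
      #outside S + 1                                             ≡⟨ cong (#outside S +_) (sym (∑-δ (root final s₀))) ⟩
      #outside S + ∑ (λ x → 𝟙 (x ≟ root final s₀))                ≡⟨ sym (ℕSums.∑-distrib-+ _ (λ x → 𝟙 (x ≟ root final s₀))) ⟩
      ∑ (λ x → 𝟙 (not (does (x ∈? S))) + 𝟙 (x ≟ root final s₀))   ≤⟨ ∑-mono-≤ pointwise ⟩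
      #roots final                                               ∎
      where
      open ℕP.≤-Reasoning
      pointwise : ∀ x → 𝟙 (not (does (x ∈? S))) + 𝟙 (x ≟ root final s₀) ℕ.≤ 𝟙 (root final x ≟ x)
      pointwise x with x ∈? S
      ... | yes _   = 𝟙-mono λ x≟r → ≡⇒T≟ (trans (cong (root final) (T≟⇒≡ x≟r)) (trans (root-idem s₀) (sym (T≟⇒≡ x≟r))))
      ... | no  x∉S = subst₂ ℕ._≤_ (cong (1 +_) (sym (𝟙≟-no λ x≡r → x∉S (subst (_∈ S) (sym x≡r) (root-inside s₀∈S)))))
                                    (sym (𝟙≟-yes (outside-is-root x∉S))) ℕP.≤-refl

    #accepted<∣S∣ : ∀ {s₀} → s₀ ∈ S → #₂ (accepted final) + 1 ℕ.≤ ∣ S ∣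
    #accepted<∣S∣ s₀∈S = ℕP.+-cancelˡ-≤ (#outside S) _ _ (begin
      #outside S + (#₂ (accepted final) + 1)    ≡⟨ rearrange (#outside S) (#₂ (accepted final)) ⟩
      (#outside S + 1) + #₂ (accepted final)    ≤⟨ ℕP.+-monoˡ-≤ (#₂ (accepted final)) (#roots-outside s₀∈S) ⟩
      #roots final + #₂ (accepted final)        ≡⟨ roots+accepted ⟩
      n G                                       ≡⟨ sym (#outside+∣S∣ S) ⟩
      #outside S + ∣ S ∣                        ∎)
      where
      open ℕP.≤-Reasoning
      rearrange : ∀ a b → a + (b + 1) ≡ (a + 1) + b
      rearrange = solve-∀

  forest-edges-inside : ∀ {s₀} → s₀ ∈ S → #₂ (isEdge G ∧₂ (F ∧₂ pairsIn S)) ℕ.≤ ∣ S ∣ ∸ 1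
  forest-edges-inside s₀∈S =
    ℕP.≤-trans (#₂-mono (λ {u} {v} → F-edges-accepted {u} {v})) (ℕP.m+n≤o⇒m≤o∸n _ (#accepted<∣S∣ s₀∈S))

-- The rank inequality

RatioLowerBound : Graph → ℚ → Set
RatioLowerBound G m = ∀ S → InCo₂ G S → m ℚ.* ℕtoℚ (eInduced G S) ℚ.≤ ℕtoℚ (∣ S ∣ ∸ 1)

module Rank (G : Graph) (C : PairSet (n G)) {m : ℚ} (m≥0 : ℚ.0ℚ ℚ.≤ m) (m-bound : RatioLowerBound G m) where
  open UnionFind G C

  module _ {s : State} (I : Invariant s) where
    open Invariant I

    block : Fin (n G) → Subset (n G)
    block r = Vec.tabulate λ x → root s x ≟ r

    ∈-block⁻ : ∀ {r x} → x ∈ block r → root s x ≡ r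
    ∈-block⁻ {r} {x} x∈ = T≟⇒≡ (subst T (∈?-tabulate (λ y → root s y ≟ r) x) (∈⇒T x∈))

    ∈-block⁺ : ∀ {r x} → root s x ≡ r → x ∈ block r
    ∈-block⁺ {r} {x} rx≡r = T⇒∈ (subst T (sym (∈?-tabulate (λ y → root s y ≟ r) x)) (≡⇒T≟ rx≡r))

    block-connected : ∀ r → InducedConnected G (block r)
    block-connected r u v u∈ v∈ = Reach-map inside
      (Reach-restrict (λ z → root s z ≡ r) (λ rz≡r step → trans (sym (accepted-root I step)) rz≡r) (∈-block⁻ u∈)
        (root-reach (trans (∈-block⁻ u∈) (sym (∈-block⁻ v∈)))))
      where
      inside : ∀ {a b} → root s a ≡ r × root s b ≡ r × AdjF G (accepted s) a b →
               a ∈ block r × b ∈ block r × Adj G a b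
      inside (ra≡r , rb≡r , inj₁ (_ , ab , _)) = ∈-block⁺ ra≡r , ∈-block⁺ rb≡r , ab
      inside (ra≡r , rb≡r , inj₂ (_ , ba , _)) = ∈-block⁺ ra≡r , ∈-block⁺ rb≡r , Adj-sym G ba

    block-bound : ∀ r → m ℚ.* ℕtoℚ (eInduced G (block r)) ℚ.≤ ℕtoℚ (∣ block r ∣ ∸ 1)
    block-bound r with 2 ℕ.≤? ∣ block r ∣
    ... | yes 2≤ = m-bound (block r) (block-connected r , 2≤)
    ... | no  2≰ with eInduced G (block r) in e≡
    ...   | zero  = subst (ℚ._≤ ℕtoℚ (∣ block r ∣ ∸ 1)) (sym (ℚP.*-zeroʳ m)) (0≤ℕtoℚ (∣ block r ∣ ∸ 1))
    ...   | suc _ = ⊥-elim (2≰ (induced-edge⇒2≤∣S∣ G (block r) (subst (0 ℕ.<_) (sym e≡) (s≤s z≤n))))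

    ∣block∣≡∑ : ∀ r → ∣ block r ∣ ≡ ∑ λ x → 𝟙 (root s x ≟ r)
    ∣block∣≡∑ r = trans (∣S∣≡∑ (block r)) (∑-cong λ x → cong 𝟙 (∈?-tabulate (λ y → root s y ≟ r) x))

    private
      inside : Fin (n G) → Fin (n G) → Fin (n G) → ℕ
      inside r u v = 𝟙 (isEdge G u v ∧ (root s u ≟ r ∧ root s v ≟ r))

      eInduced-block : ∀ r → eInduced G (block r) ≡ ∑ λ u → ∑ λ v → inside r u v
      eInduced-block r = trans (eInduced≡#₂ G (block r)) (∑-cong λ u → ∑-cong λ v →
        cong₂ (λ a b → 𝟙 (isEdge G u v ∧ (a ∧ b))) (∈?-tabulate (λ y → root s y ≟ r) u) (∈?-tabulate (λ y → root s y ≟ r) v))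

    processed≤blocks : #₂ (processed s) ℕ.≤ ∑ λ r → eInduced G (block r)
    processed≤blocks = begin
      #₂ (processed s)                        ≤⟨ ∑-mono-≤ (λ u → ∑-mono-≤ λ v → counted u v) ⟩
      ∑ (λ u → ∑ λ v → ∑ λ r → inside r u v)   ≡⟨ ∑-cong (λ u → ℕSums.∑-comm (λ v r → inside r u v)) ⟩
      ∑ (λ u → ∑ λ r → ∑ λ v → inside r u v)   ≡⟨ ℕSums.∑-comm (λ u r → ∑ λ v → inside r u v) ⟩
      ∑ (λ r → ∑ λ u → ∑ λ v → inside r u v)   ≡⟨ ∑-cong (sym ∘ eInduced-block) ⟩
      ∑ (λ r → eInduced G (block r))           ∎
      where
      open ℕP.≤-Reasoning
      counted : ∀ u v → 𝟙 (processed s u v) ℕ.≤ ∑ λ r → inside r u v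
      counted u v = ℕP.≤-trans
        (𝟙-mono λ uv∈ → T-∧⁺ (processed⊆edges uv∈) (T-∧⁺ (≡⇒T≟ {x = root s u} refl) (≡⇒T≟ (sym (processed-root uv∈)))))
        (term≤∑ (λ r → inside r u v) (root s u))

    blocks≡accepted : ∑ (λ r → ∣ block r ∣ ∸ 1) ≡ #₂ (accepted s)
    blocks≡accepted = ℕP.+-cancelˡ-≡ (#roots s) _ _ (begin
      #roots s + ∑ (λ r → ∣ block r ∣ ∸ 1)                ≡⟨ ℕP.+-comm (#roots s) _ ⟩
      ∑ (λ r → ∣ block r ∣ ∸ 1) + #roots s                ≡⟨ sym (ℕSums.∑-distrib-+ (λ r → ∣ block r ∣ ∸ 1) _) ⟩
      ∑ (λ r → (∣ block r ∣ ∸ 1) + 𝟙 (root s r ≟ r))      ≡⟨ ∑-cong pointwise ⟩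
      ∑ (λ r → ∣ block r ∣)                              ≡⟨ ∑-cong ∣block∣≡∑ ⟩
      ∑ (λ r → ∑ λ x → 𝟙 (root s x ≟ r))                 ≡⟨ ℕSums.∑-comm (λ r x → 𝟙 (root s x ≟ r)) ⟩
      ∑ (λ x → ∑ λ r → 𝟙 (root s x ≟ r))                 ≡⟨ ∑-cong (λ x → trans (∑-cong λ r → cong 𝟙 (≟-sym (root s x) r)) (∑-δ (root s x))) ⟩
      ∑ {n G} (λ _ → 1)                                  ≡⟨ ∑-const-1 (n G) ⟩
      n G                                                ≡⟨ sym roots+accepted ⟩
      #roots s + #₂ (accepted s)                         ∎)
      where
      open ≡-Reasoning
      pointwise : ∀ r → (∣ block r ∣ ∸ 1) + 𝟙 (root s r ≟ r) ≡ ∣ block r ∣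
      pointwise r with root s r FinP.≟ r
      ... | yes rr≡r = ℕP.m∸n+n≡m (ℕP.≤-trans (s≤s z≤n) (SubsetP.x∈p⇒∣p-x∣<∣p∣ (∈-block⁺ rr≡r)))
      ... | no  rr≢r = trans (cong (λ k → (k ∸ 1) + 0) empty) (sym empty)
        where
        empty : ∣ block r ∣ ≡ 0
        empty = trans (∣block∣≡∑ r) (trans (∑-cong λ x → 𝟙≟-no (rr≢r ∘ root-of x)) (ℕSums.sum-replicate-zero (n G)))
          where
          root-of : ∀ x → root s x ≡ r → root s r ≡ r
          root-of x rx≡r = trans (cong (root s) (sym rx≡r)) (trans (root-idem x) rx≡r)

    rank-bound : m ℚ.* ℕtoℚ (#₂ (processed s)) ℚ.≤ ℕtoℚ (#₂ (accepted s))
    rank-bound = begin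
      m ℚ.* ℕtoℚ (#₂ (processed s))                       ≤⟨ ℚP.*-monoˡ-≤-nonNeg m {{ℚ.nonNegative m≥0}} (ℕtoℚ-mono-≤ processed≤blocks) ⟩
      m ℚ.* ℕtoℚ (∑ λ r → eInduced G (block r))          ≡⟨ cong (m ℚ.*_) (ℕtoℚ-∑ (λ r → eInduced G (block r))) ⟩
      m ℚ.* ∑ℚ (λ r → ℕtoℚ (eInduced G (block r)))        ≡⟨ ℚSums.*-distribˡ-sum m (λ r → ℕtoℚ (eInduced G (block r))) ⟩
      ∑ℚ (λ r → m ℚ.* ℕtoℚ (eInduced G (block r)))        ≤⟨ ∑ℚ-mono-≤ block-bound ⟩
      ∑ℚ (λ r → ℕtoℚ (∣ block r ∣ ∸ 1))                   ≡⟨ sym (ℕtoℚ-∑ (λ r → ∣ block r ∣ ∸ 1)) ⟩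
      ℕtoℚ (∑ λ r → ∣ block r ∣ ∸ 1)                      ≡⟨ cong ℕtoℚ blocks≡accepted ⟩
      ℕtoℚ (#₂ (accepted s))                               ∎
      where open ℚP.≤-Reasoning

-- Kruskal's algorithm

module Kruskal (G : Graph) (ω : Weight G) where
  open UnionFind G (λ _ _ → true)

  weightOf : Fin (n G) × Fin (n G) → ℚ
  weightOf e = ω (proj₁ e) (proj₂ e)

  -- Sorting with respect to this order lists the edges by non-increasing weight.
  open Sort (On.decTotalOrder (Flip.decTotalOrder ℚP.≤-decTotalOrder) weightOf) using (sort; sort-↭; sort-↗)

  sortedEdges : List (Fin (n G) × Fin (n G))
  sortedEdges = sort (edges G)

  final : State
  final = process sortedEdges initial

  final-invariant : Invariant final
  final-invariant = process-invariant initial-invariant sortedEdges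

  final-complete : Complete final
  final-complete = process-complete sortedEdges initial λ e _ → ∈-resp-↭ (↭-sym (sort-↭ (edges G))) (∈-edges⁺ G e)

  K : EdgeSet G
  K = accepted final

  K-spanning-tree : Connected G → SpanningTree G K
  K-spanning-tree connected =
    (λ u v → Invariant.root-reach final-invariant (Reach-invariant (root final) adj⇒same-root (connected u v))) ,
    accepted-acyclic final-invariant
    where
    adj⇒same-root : ∀ {a b} → Adj G a b → root final a ≡ root final b
    adj⇒same-root ab with Adj⇒isEdge G ab
    ... | inj₁ e = complete⇒same-root final-invariant final-complete e _
    ... | inj₂ e = sym (complete⇒same-root final-invariant final-complete e _)

  module Bound {m : ℚ} (m≥0 : ℚ.0ℚ ℚ.≤ m) (m-bound : RatioLowerBound G m)
               (ω≥0 : ∀ {u v} → T (isEdge G u v) → ℚ.0ℚ ℚ.≤ ω u v) where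
    open Rank G (λ _ _ → true) m≥0 m-bound

    private
      Gap : (A P a k w : ℚ) → ℚ
      Gap A P a k w = (A ℚ.- m ℚ.* P) ℚ.- (a ℚ.- m ℚ.* k) ℚ.* w

      Gap-shift : ∀ A P a k w w′ → Gap A P a k w′ ≡ Gap A P a k w ℚ.+ (a ℚ.- m ℚ.* k) ℚ.* (w ℚ.- w′)
      Gap-shift A P a k w w′ = ℚSolver.+-*-Solver.solve 7
        (λ A P a k m w w′ → (A :- m :* P) :- (a :- m :* k) :* w′
                            := ((A :- m :* P) :- (a :- m :* k) :* w) :+ (a :- m :* k) :* (w :- w′))
        refl A P a k m w w′

      Gap-reject : ∀ A P a k w → Gap A (P ℚ.+ w) a (k ℚ.+ ℚ.1ℚ) w ≡ Gap A P a k w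
      Gap-reject A P a k w = ℚSolver.+-*-Solver.solve 6
        (λ A P a k m w → (A :- m :* (P :+ w)) :- (a :- m :* (k :+ con ℚ.1ℚ)) :* w := (A :- m :* P) :- (a :- m :* k) :* w)
        refl A P a k m w

      Gap-merge : ∀ A P a k w → Gap (A ℚ.+ w) (P ℚ.+ w) (a ℚ.+ ℚ.1ℚ) (k ℚ.+ ℚ.1ℚ) w ≡ Gap A P a k w
      Gap-merge A P a k w = ℚSolver.+-*-Solver.solve 6
        (λ A P a k m w → ((A :+ w) :- m :* (P :+ w)) :- ((a :+ con ℚ.1ℚ) :- m :* (k :+ con ℚ.1ℚ)) :* w
                         := (A :- m :* P) :- (a :- m :* k) :* w)
        refl A P a k m w

      Gap-empty : ∀ w → Gap ℚ.0ℚ ℚ.0ℚ ℚ.0ℚ ℚ.0ℚ w ≡ ℚ.0ℚ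
      Gap-empty w = ℚSolver.+-*-Solver.solve 2
        (λ m w → (con ℚ.0ℚ :- m :* con ℚ.0ℚ) :- (con ℚ.0ℚ :- m :* con ℚ.0ℚ) :* w := con ℚ.0ℚ) refl m w

      Gap-zero : ∀ A P a k → Gap A P a k ℚ.0ℚ ≡ A ℚ.- m ℚ.* P
      Gap-zero A P a k = ℚSolver.+-*-Solver.solve 5
        (λ A P a k m → (A :- m :* P) :- (a :- m :* k) :* con ℚ.0ℚ := A :- m :* P) refl A P a k m

      ωA ωP #A #P : State → ℚ
      ωA s = weight ω (accepted s)
      ωP s = weight ω (processed s)
      #A s = ℕtoℚ (#₂ (accepted s))
      #P s = ℕtoℚ (#₂ (processed s))

    -- gap s w = ω(A) - m ω(P) - (|A| - m |P|) w for the accepted and processed edges A and P.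
    -- Visiting an edge of weight w leaves gap s w unchanged, and lowering w does not decrease it
    -- because |A| ≥ m |P| (rank-bound); so visiting the edges by non-increasing weight keeps it
    -- nonnegative down to w = 0, where it is ω(K) - m ω(G).  This is Abel summation over the weights.
    gap : State → ℚ → ℚ
    gap s = Gap (ωA s) (ωP s) (#A s) (#P s)

    gap-lower : ∀ {s w w′} → Invariant s → w′ ℚ.≤ w → ℚ.0ℚ ℚ.≤ gap s w → ℚ.0ℚ ℚ.≤ gap s w′
    gap-lower {s} {w} {w′} I w′≤w gap≥0 = subst (ℚ.0ℚ ℚ.≤_) (sym (Gap-shift (ωA s) (ωP s) (#A s) (#P s) w w′))
      (0≤+ gap≥0 (0≤* (≤⇒0≤- (rank-bound I)) (≤⇒0≤- w′≤w)))

    gap-join : ∀ {s p q} → Invariant s → T (candidate s p q) → gap (join s p q) (ω p q) ≡ gap s (ω p q)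
    gap-join {s} {p} {q} I c = by-cases (root s p ≟ root s q)
      where
      pq∉P : ¬ T (processed s p q)
      pq∉P = proj₂ (proj₂ (candidate⇒ {s} {p} {q} c))
      pq∉A : ¬ T (accepted s p q)
      pq∉A = pq∉P ∘ Invariant.accepted⊆processed I
      #insert : ∀ X → ¬ T (X p q) → ℕtoℚ (#₂ (insert X p q)) ≡ ℕtoℚ (#₂ X) ℚ.+ ℚ.1ℚ
      #insert X pq∉X = trans (cong ℕtoℚ (#₂-insert X pq∉X)) (ℕtoℚ-+ (#₂ X) 1)
      by-cases : ∀ b → gap (if b then reject s p q else merge s p q) (ω p q) ≡ gap s (ω p q)
      by-cases true  = trans
        (cong₂ (λ P k → Gap (ωA s) P (#A s) k (ω p q)) (weight-insert ω (processed s) pq∉P) (#insert (processed s) pq∉P))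
        (Gap-reject (ωA s) (ωP s) (#A s) (#P s) (ω p q))
      by-cases false = trans
        (cong₂ (λ (A , a) (P , k) → Gap A P a k (ω p q))
               (cong₂ _,_ (weight-insert ω (accepted s) pq∉A) (#insert (accepted s) pq∉A))
               (cong₂ _,_ (weight-insert ω (processed s) pq∉P) (#insert (processed s) pq∉P)))
        (Gap-merge (ωA s) (ωP s) (#A s) (#P s) (ω p q))

    gap-initial : ∀ w → gap initial w ≡ ℚ.0ℚ
    gap-initial w = trans
      (cong₂ (λ W k → Gap W W (ℕtoℚ k) (ℕtoℚ k) w) (weight-empty (n G) ω) (#₂-empty (n G)))
      (Gap-empty w)

    gap-visit : ∀ {s} → Invariant s → ∀ e → ℚ.0ℚ ℚ.≤ gap s (weightOf e) → ℚ.0ℚ ℚ.≤ gap (visit s e) (weightOf e)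
    gap-visit {s} I (p , q) gap≥0 = by-cases (candidate s p q) refl
      where
      by-cases : ∀ b → candidate s p q ≡ b → ℚ.0ℚ ℚ.≤ gap (if b then join s p q else s) (ω p q)
      by-cases true  c = subst (ℚ.0ℚ ℚ.≤_) (sym (gap-join I (subst T (sym c) _))) gap≥0
      by-cases false _ = gap≥0

    gap-process : ∀ {s} w es → Invariant s → ℚ.0ℚ ℚ.≤ w → ℚ.0ℚ ℚ.≤ gap s w →
                  Linked (λ x y → y ℚ.≤ x) (w ∷ map weightOf es) → All (λ e → ℚ.0ℚ ℚ.≤ weightOf e) es →
                  ℚ.0ℚ ℚ.≤ gap (process es s) ℚ.0ℚ
    gap-process w []       I w≥0 gap≥0 _              _            = gap-lower I w≥0 gap≥0
    gap-process w (e ∷ es) I _   gap≥0 (e≤w ∷ sorted) (e≥0 ∷ es≥0) =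
      gap-process (weightOf e) es (visit-invariant I e) e≥0 (gap-visit I e (gap-lower I e≤w gap≥0)) sorted es≥0

    final-gap : ℚ.0ℚ ℚ.≤ gap final ℚ.0ℚ
    final-gap = from-initial sortedEdges (LinkedP.map⁺ (sort-↗ (edges G)))
                  (All.tabulate λ e∈ → ω≥0 (∈-edges⁻ G (∈-resp-↭ (sort-↭ (edges G)) e∈)))
      where
      from-initial : ∀ es → Linked (λ x y → y ℚ.≤ x) (map weightOf es) → All (λ e → ℚ.0ℚ ℚ.≤ weightOf e) es →
                     ℚ.0ℚ ℚ.≤ gap (process es initial) ℚ.0ℚ
      from-initial []       _      _              = ℚP.≤-reflexive (sym (gap-initial ℚ.0ℚ))
      from-initial (e ∷ es) sorted (e≥0 ∷ es≥0) = gap-process (weightOf e) (e ∷ es) initial-invariant e≥0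
        (ℚP.≤-reflexive (sym (gap-initial (weightOf e)))) (ℚP.≤-refl ∷ sorted) (e≥0 ∷ es≥0)

    kruskal-bound : m ℚ.* ωG G ω ℚ.≤ ωT G ω K
    kruskal-bound = subst₂ (λ P A → m ℚ.* P ℚ.≤ A) processed≡ accepted≡
      (0≤-⇒≤ (subst (ℚ.0ℚ ℚ.≤_) (Gap-zero (ωA final) (ωP final) (#A final) (#P final)) final-gap))
      where
      processed≡ : ωP final ≡ ωG G ω
      processed≡ = trans
        (weight-cong ω (⊆₂-antisym (Invariant.processed⊆edges final-invariant) (λ e → final-complete (T-∧⁺ e _))))
        (sym (ωG≡weight G ω))
      accepted≡ : ωA final ≡ ωT G ω K
      accepted≡ = trans
        (weight-cong ω (⊆₂-antisym (λ a → T-∧⁺ (accepted⊆edges final-invariant a) a) (proj₂ ∘ T-∧⁻ _)))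
        (sym (ωT≡weight G ω K))
-- The extremal set

module _ {A : Set} (f : A → ℚ) {P : A → Set} (P? : ∀ x → Dec (P x)) where
  open import Data.List.Extrema (DecTotalOrder.totalOrder ℚP.≤-decTotalOrder) using (argmin; argmin-all; f[argmin]≤f[xs])

  minimiser : ∀ {x₀} → P x₀ → ∀ xs → Σ A λ x → P x × ∀ y → y ∈ₗ xs → P y → f x ℚ.≤ f y
  minimiser {x₀} Px₀ xs = argmin f x₀ candidates , argmin-all f Px₀ (all-filter P? xs) ,
    λ y y∈xs Py → All.lookup (f[argmin]≤f[xs] x₀ candidates) (∈-filter⁺ P? y∈xs Py)
    where
    candidates = filter P? xs

allSubsets : ∀ m → List (Subset m)
allSubsets zero    = [] ∷ []
allSubsets (suc m) = map (true ∷_) (allSubsets m) ++ map (false ∷_) (allSubsets m)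

∈-allSubsets : ∀ {m} (S : Subset m) → S ∈ₗ allSubsets m
∈-allSubsets []          = here refl
∈-allSubsets (true  ∷ S) = ∈-++⁺ˡ (∈-map⁺ (true ∷_) (∈-allSubsets S))
∈-allSubsets (false ∷ S) = ∈-++⁺ʳ (map (true ∷_) (allSubsets _)) (∈-map⁺ (false ∷_) (∈-allSubsets S))

module Extremal (G : Graph) (connected : Connected G) (has-edge : HasEdge G) where
  private
    N = n G

  minimal : Σ (Subset N) λ S₀ → InCo₂ G S₀ × ∀ S → InCo₂ G S → ratio G S₀ ℚ.≤ ratio G S
  minimal =
    let S₀ , S₀-co₂ , S₀-min = minimiser (ratio G) (InCo₂? G) (edge-co₂ G (proj₂ (proj₂ has-edge))) (allSubsets N)
    in S₀ , S₀-co₂ , λ S S-co₂ → S₀-min S (∈-allSubsets S) S-co₂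

  S₀ : Subset N
  S₀ = proj₁ minimal

  S₀-co₂ : InCo₂ G S₀
  S₀-co₂ = proj₁ (proj₂ minimal)

  m : ℚ
  m = ratio G S₀

  m-minimum : IsMinCo G m
  m-minimum = (S₀ , S₀-co₂ , refl) , proj₂ (proj₂ minimal)

  ratio-* : ∀ {S} → InCo₂ G S → ratio G S ℚ.* ℕtoℚ (eInduced G S) ≡ ℕtoℚ (∣ S ∣ ∸ 1)
  ratio-* {S} co₂ =
    divQ-*ʳ (ℕtoℚ (∣ S ∣ ∸ 1)) (ℕtoℚ (eInduced G S)) (≢-sym (ℚP.<⇒≢ (ℕtoℚ-mono-< (co₂⇒eInduced-pos G co₂))))

  m-bound : RatioLowerBound G m
  m-bound S co₂ = subst (m ℚ.* ℕtoℚ (eInduced G S) ℚ.≤_) (ratio-* co₂)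
    (ℚP.*-monoʳ-≤-nonNeg (ℕtoℚ (eInduced G S)) {{ℚ.nonNegative (0≤ℕtoℚ (eInduced G S))}}
                         (proj₂ (proj₂ minimal) S co₂))

  m≥0 : ℚ.0ℚ ℚ.≤ m
  m≥0 = ℚP.*-cancelʳ-≤-pos e₀ {{ℚ.positive (ℕtoℚ-mono-< (co₂⇒eInduced-pos G S₀-co₂))}}
    (subst₂ ℚ._≤_ (sym (ℚP.*-zeroˡ e₀)) (sym (ratio-* S₀-co₂)) (0≤ℕtoℚ (∣ S₀ ∣ ∸ 1)))
    where
    e₀ = ℕtoℚ (eInduced G S₀)

  lower-bound : ∀ ω F → InW G ω → IsMaxST G ω F → m ℚ.≤ tω G ω F
  lower-bound ω F (ω≥0 , u , v , u<v , uv , ωuv≢0) (_ , F-maximum) =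
    ≤-divQ ωG>0 (ℚP.≤-trans kruskal-bound (F-maximum K (K-spanning-tree connected)))
    where
    open Kruskal G ω
    open Bound m≥0 m-bound (isEdge-nonNeg G ω≥0)
    ωG>0 : ℚ.0ℚ ℚ.< ωG G ω
    ωG>0 = ℚP.<-≤-trans (≤∧≢⇒< (ω≥0 u v u<v uv) (≢-sym ωuv≢0))
      (subst (ω u v ℚ.≤_) (sym (ωG≡weight G ω))
             (weight-term ω (isEdge G) (λ _ _ → isEdge-nonNeg G ω≥0) (⇒isEdge G u<v uv)))

  ω₀ : Weight G
  ω₀ u v = if pairsIn S₀ u v then ℚ.1ℚ else ℚ.0ℚ

  private
    edge₀ : ∃₂ λ u v → T (isEdge G u v) × u ∈ S₀ × v ∈ S₀
    edge₀ = co₂⇒edge G S₀-co₂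

    u₀ v₀ : Fin N
    u₀ = proj₁ edge₀
    v₀ = proj₁ (proj₂ edge₀)

    u₀v₀-edge : T (isEdge G u₀ v₀)
    u₀v₀-edge = proj₁ (proj₂ (proj₂ edge₀))

    u₀∈S₀ : u₀ ∈ S₀
    u₀∈S₀ = proj₁ (proj₂ (proj₂ (proj₂ edge₀)))

    v₀∈S₀ : v₀ ∈ S₀
    v₀∈S₀ = proj₂ (proj₂ (proj₂ (proj₂ edge₀)))

  ω₀∈W : InW G ω₀
  ω₀∈W = (λ a b _ _ → indicator≥0 (pairsIn S₀ a b)) ,
         u₀ , v₀ , proj₁ (isEdge⇒ G u₀v₀-edge) , proj₂ (isEdge⇒ G u₀v₀-edge) ,
         λ ω₀u₀v₀≡0 → ℚP.1≢0 (trans (sym ω₀u₀v₀≡1) ω₀u₀v₀≡0)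
    where
    indicator≥0 : ∀ b → ℚ.0ℚ ℚ.≤ (if b then ℚ.1ℚ else ℚ.0ℚ)
    indicator≥0 true  = 0≤ℕtoℚ 1
    indicator≥0 false = ℚP.≤-refl
    ω₀u₀v₀≡1 : ω₀ u₀ v₀ ≡ ℚ.1ℚ
    ω₀u₀v₀≡1 = cong (λ b → if b then ℚ.1ℚ else ℚ.0ℚ)
                    (Equivalence.to BoolP.T-≡ (T-∧⁺ (∈⇒T u₀∈S₀) (∈⇒T v₀∈S₀)))

  ωG-ω₀ : ωG G ω₀ ≡ ℕtoℚ (eInduced G S₀)
  ωG-ω₀ = trans (ωG≡weight G ω₀)
          (trans (weight-indicator (isEdge G) (pairsIn S₀)) (cong ℕtoℚ (sym (eInduced≡#₂ G S₀))))

  tree-ω₀-bound : ∀ F → SpanningTree G F → ωT G ω₀ F ℚ.≤ ℕtoℚ (∣ S₀ ∣ ∸ 1)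
  tree-ω₀-bound F (_ , F-acyclic) = subst (ℚ._≤ ℕtoℚ (∣ S₀ ∣ ∸ 1)) (sym ωT≡#)
    (ℕtoℚ-mono-≤ (ForestInside.forest-edges-inside G F F-acyclic S₀ u₀∈S₀))
    where
    ωT≡# : ωT G ω₀ F ≡ ℕtoℚ (#₂ (isEdge G ∧₂ (F ∧₂ pairsIn S₀)))
    ωT≡# = trans (ωT≡weight G ω₀ F) (trans (weight-indicator (isEdge G ∧₂ F) (pairsIn S₀))
            (cong ℕtoℚ (#₂-cong λ u v → BoolP.∧-assoc (isEdge G u v) (F u v) (pairsIn S₀ u v))))

  open Kruskal G ω₀ using () renaming (K to K₀; K-spanning-tree to K₀-spanning-tree)

  K₀-weight : ωT G ω₀ K₀ ≡ ℕtoℚ (∣ S₀ ∣ ∸ 1)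
  K₀-weight = ℚP.≤-antisym (tree-ω₀-bound K₀ (K₀-spanning-tree connected))
    (subst (ℚ._≤ ωT G ω₀ K₀) (trans (cong (m ℚ.*_) ωG-ω₀) (ratio-* S₀-co₂)) kruskal-bound)
    where open Kruskal.Bound G ω₀ m≥0 m-bound (isEdge-nonNeg G (proj₁ ω₀∈W))

  upper-bound : ∀ ε → ℚ.0ℚ ℚ.< ε → Σ (Weight G) λ ω → Σ (EdgeSet G) λ F →
                InW G ω × IsMaxST G ω F × tω G ω F ℚ.< m ℚ.+ ε
  upper-bound ε ε>0 = ω₀ , K₀ , ω₀∈W ,
    (K₀-spanning-tree connected , λ F F-tree → subst (ωT G ω₀ F ℚ.≤_) (sym K₀-weight) (tree-ω₀-bound F F-tree)) ,
    subst (ℚ._< m ℚ.+ ε) (sym (cong₂ divQ K₀-weight ωG-ω₀))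
          (subst (ℚ._< m ℚ.+ ε) (ℚP.+-identityʳ m) (ℚP.+-monoʳ-< m ε>0))

theorem3 : (G : Graph) → Connected G → HasEdge G →
    Σ ℚ λ m → IsMinCo G m × IsInfT G m
theorem3 G connected has-edge = m , m-minimum , lower-bound , upper-bound
  where open Extremal G connected has-edge
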